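{- Let $\mathbb{K}$ be a field, let $d\ge q$ be positive integers, and let $R=\mathbb{K}[x,y]/\langle x^{d+1},y^{q+1}\rangle=\bigoplus_{k=0}^{d+q}R_k$ with its standard grading. Let $k$ be an integer with $0\le k\le \frac{d+q}{2}$ and put $n=d+q-2k$. Let $a_1,\dots,a_n,b_1,\dots,b_n\in\mathbb{K}$ with $\beta=b_1b_2\cdots b_n\neq 0$, and put $l_t=a_tx+b_ty\in R_1$. Let $D_{d,q}(\boldsymbol a;\boldsymbol b)$ denote the determinant of the $\mathbb{K}$-linear map $R_k\to R_{d+q-k}$, $f\mapsto f\cdot l_1l_2\cdots l_n$, with respect to the ordered bases $\mathcal B_k$ and $\mathcal B_{d+q-k}$. Write $\frac{\boldsymbol a}{\boldsymbol b}=\left(\frac{a_1}{b_1},\dots,\frac{a_n}{b_n}\right)$. Then: (1) if $0\le k\le q$, then $D_{d,q}(\boldsymbol a;\boldsymbol b)=\beta^{k+1}\, s_{((k+1)^{d-k})}\!\left(\frac{\boldsymbol a}{\boldsymbol b}\right)$; (2) if $q\le k\le \frac{d+q}{2}$, then $D_{d,q}(\boldsymbol a;\boldsymbol b)=\beta^{q+1}\, s_{((q+1)^{d+q-2k})}\!\left(\frac{\boldsymbol a}{\boldsymbol b}\right)$.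
   Context: $R_m$ is the image of the degree-$m$ homogeneous polynomials; it has $\mathbb{K}$-basis $\mathcal B_m=\{x^iy^{m-i} : 0\le i\le d,\ 0\le m-i\le q\}$, ordered by increasing exponent of $y$ (i.e. decreasing exponent of $x$). For $0\le k\le\frac{d+q}{2}$ one has $\dim R_k=\dim R_{d+q-k}$, so the matrix is square. For nonnegative integers $r,l$, $(r^l)$ denotes the partition consisting of $l$ parts equal to $r$. For a partition $\lambda=(\lambda_1,\lambda_2,\dots)$ with at most $n$ nonzero parts, the Schur polynomial in $n$ variables $z=(z_1,\dots,z_n)$ is $s_\lambda(z)=\det\big(z_j^{\lambda_i+n-i}\big)_{i,j=1}^n/\det\big(z_j^{n-i}\big)_{i,j=1}^n$ (a symmetric polynomial, homogeneous of degree $\sum_i\lambda_i$); for $n=0$ and the empty partition, $s_\emptyset=1$. Here $s_\lambda$ is taken in $n=d+q-2k$ variables and evaluated at $\frac{\boldsymbol a}{\boldsymbol b}$. -}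

module Defs where

open import Level using (_⊔_) renaming (suc to lsuc)
open import Algebra.Bundles using (CommutativeRing)
open import Algebra.Bundles.Raw using (RawRing)
open import Data.Nat using (ℕ; zero; suc; _∸_; _⊓_; _<?_; _≤?_) renaming (_+_ to _+ℕ_)
open import Data.Fin using (Fin; zero; suc; toℕ; punchIn; _≟_)
open import Data.Vec using (Vec; lookup; tabulate; replicate; zipWith)
import Data.Vec.Properties as VecP
open import Data.List using (List; []; _∷_; _++_; map; concatMap)
open import Data.Product using (_×_; _,_; proj₁; proj₂; map₁)
open import Relation.Nullary using (¬_; yes; no)
open import Data.Nat.Properties using () renaming (_≟_ to _≟ℕ_)

-- Fields: a commutative ring with 0 ≉ 1 and an inverse operation that
-- is a right inverse on every nonzero element (value at 0 irrelevant).

record Field c ℓ : Set (lsuc (c ⊔ ℓ)) where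
  field
    commutativeRing : CommutativeRing c ℓ
  open CommutativeRing commutativeRing public
  field
    _⁻¹          : Carrier → Carrier
    ⁻¹-inverseʳ  : ∀ x → ¬ (x ≈ 0#) → (x * (x ⁻¹)) ≈ 1#
    0≉1          : ¬ (0# ≈ 1#)

module RingOps {c ℓ} (R : RawRing c ℓ) where
  open RawRing R

  ΣF : ∀ {n} → (Fin n → Carrier) → Carrier
  ΣF {zero}  f = 0#
  ΣF {suc n} f = f zero + ΣF (λ i → f (suc i))

  ΠF : ∀ {n} → (Fin n → Carrier) → Carrier
  ΠF {zero}  f = 1#
  ΠF {suc n} f = f zero * ΠF (λ i → f (suc i))

  pow : Carrier → ℕ → Carrier
  pow x zero    = 1#
  pow x (suc e) = x * pow x e

  sign : ℕ → Carrier
  sign zero    = 1#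
  sign (suc i) = - sign i

  det : ∀ {n} → (Fin n → Fin n → Carrier) → Carrier
  det {zero}  M = 1#
  det {suc n} M =
    ΣF (λ j → sign (toℕ j) * (M zero j * det (λ r s → M (suc r) (punchIn j s))))

module FieldDefs {c ℓ} (𝕂 : Field c ℓ) where
  open Field 𝕂 public using (Carrier; _≈_; _+_; _*_; -_; 0#; 1#; _⁻¹; rawRing)
  open RingOps rawRing public

  -- Polynomials in n variables z_0,…,z_{n-1} over 𝕂: finite lists of
  -- terms (coefficient, exponent vector); equality is coefficientwise.

  Poly : ℕ → Set c
  Poly n = List (Carrier × Vec ℕ n)

  coeff : ∀ {n} → Poly n → Vec ℕ n → Carrier
  coeff []            e = 0#
  coeff ((a , m) ∷ p) e with VecP.≡-dec _≟ℕ_ m e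
  ... | yes _ = a + coeff p e
  ... | no  _ = coeff p e

  _≈ₚ_ : ∀ {n} → Poly n → Poly n → Set ℓ
  P ≈ₚ Q = ∀ e → coeff P e ≈ coeff Q e

  polyRawRing : ℕ → RawRing c ℓ
  polyRawRing n = record
    { Carrier = Poly n
    ; _≈_ = _≈ₚ_
    ; _+_ = _++_
    ; _*_ = λ P Q → concatMap (λ t → map (λ u → (proj₁ t * proj₁ u , zipWith _+ℕ_ (proj₂ t) (proj₂ u))) Q) P
    ; -_ = map (map₁ (-_))
    ; 0# = []
    ; 1# = (1# , replicate n 0) ∷ []
    }

  varPow : ∀ {n} → Fin n → ℕ → Poly n
  varPow {n} j e = (1# , tabulate (λ i → exp i)) ∷ []
    where
    exp : Fin n → ℕ
    exp i with i ≟ j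
    ... | yes _ = e
    ... | no  _ = 0

  evalP : ∀ {n} → (Fin n → Carrier) → Poly n → Carrier
  evalP w []            = 0#
  evalP w ((a , m) ∷ p) = a * ΠF (λ i → pow (w i) (lookup m i)) + evalP w p

  -- Schur polynomials.  A partition with at most n parts is given by its
  -- parts λ_1 ≥ … ≥ λ_n (0-indexed here: λ i = λ_{i+1}).
  -- alternant λ = det (z_j ^ (λ_i + n - i))_{i,j}  (1-indexed i)

  alternant : ∀ n → (Fin n → ℕ) → Poly n
  alternant n λp =
    RingOps.det (polyRawRing n) (λ i j → varPow j (λp i +ℕ (n ∸ 1 ∸ toℕ i)))

  -- s_λ is the polynomial P with P · det(z_j^{n-i}) = det(z_j^{λ_i+n-i})
  IsSchurPoly : ∀ n → (Fin n → ℕ) → Poly n → Set ℓ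
  IsSchurPoly n λp P =
    RawRing._*_ (polyRawRing n) P (alternant n (λ _ → 0)) ≈ₚ alternant n λp

  -- the rectangular partition (r^l) viewed with n parts (padded by zeros)
  rect : ∀ {n} → ℕ → ℕ → Fin n → ℕ
  rect r l i with toℕ i <? l
  ... | yes _ = r
  ... | no  _ = 0

  -- The multiplication matrix on R = 𝕂[x,y]/⟨x^{d+1}, y^{q+1}⟩.
  -- B_m = {x^i y^(m-i) : 0 ≤ i ≤ d, 0 ≤ m-i ≤ q}, ordered by increasing
  -- y-exponent j, which runs over m ∸ d , … , min(q,m).

  dimR : ℕ → ℕ → ℕ → ℕ
  dimR d q m = suc (q ⊓ m) ∸ (m ∸ d)

  yExp : ∀ {N} → ℕ → ℕ → Fin N → ℕ
  yExp d m t = (m ∸ d) +ℕ toℕ t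

  -- coefficient of x^(n-s) y^s in the product ∏_t (a_t x + b_t y)
  prodCoeff : ∀ {n} → (Fin n → Carrier) → (Fin n → Carrier) → ℕ → Carrier
  prodCoeff {zero}  a b zero    = 1#
  prodCoeff {zero}  a b (suc s) = 0#
  prodCoeff {suc n} a b zero    = a zero * prodCoeff (λ t → a (suc t)) (λ t → b (suc t)) zero
  prodCoeff {suc n} a b (suc s) =
    a zero * prodCoeff (λ t → a (suc t)) (λ t → b (suc t)) (suc s)
    + b zero * prodCoeff (λ t → a (suc t)) (λ t → b (suc t)) s

  -- Matrix of f ↦ f · l_1⋯l_n : R_k → R_{d+q-k} w.r.t. B_k (columns) and
  -- B_{d+q-k} (rows).  Entry (r, c): coordinate at the r-th element of
  -- B_{d+q-k} of (c-th element of B_k) · l_1⋯l_n.  Both bases have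
  -- dimR d q k elements when 2k ≤ d+q.
  multMatrix : ∀ {n} (d q k : ℕ) → (Fin n → Carrier) → (Fin n → Carrier) →
               Fin (dimR d q k) → Fin (dimR d q k) → Carrier
  multMatrix d q k a b r col with yExp d k col ≤? yExp d (d +ℕ q ∸ k) r
  ... | yes _ = prodCoeff a b (yExp d (d +ℕ q ∸ k) r ∸ yExp d k col)
  ... | no  _ = 0#

  Ddet : ∀ {n} (d q k : ℕ) → (Fin n → Carrier) → (Fin n → Carrier) → Carrier
  Ddet d q k a b = det (multMatrix d q k a b)

  ratio : ∀ {n} → (Fin n → Carrier) → (Fin n → Carrier) → Fin n → Carrier
  ratio a b t = a t * (b t ⁻¹)

{-# OPTIONS --safe #-}
module Submission where

-- In the monomial bases the matrix of f ↦ f · l₁⋯lₙ : R_k → R_{d+q-k} is a Toeplitz matrix whose entries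
-- are coefficients of l₁⋯lₙ = β · ∏ₜ (aₜ/bₜ · x + y), i.e. β · e_j(a/b).  Taking β out of every row leaves
-- the Jacobi–Trudi matrix (e_{L-i+c}) of size m = dim R_k, with L = d - k (if k ≤ q) or L = n (if q ≤ k),
-- and the dual Jacobi–Trudi identity identifies its determinant with the Schur polynomial of (m^L).
--
-- The identity det(e_{L-i+c}) · V = A_{(m^L)}, with V the Vandermonde and A the alternant in n variables
-- z, is proved over an arbitrary commutative ring (and then applied to polynomials) with one matrix Y of
-- size m + n: its first n columns are (z_k^{m+n-1-i})_i, its last m columns the unit vectors e_{L+c}.
-- Expanding along the unit columns leaves ± A.  Adding to each of the first m rows the combination
-- ∑_{s<n} (-1)^{n+s} e_{n-s}(z) · (row i+n-s) turns their Vandermonde part into multiples of ∏ₜ (zₜ - z_k),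
-- which vanish, and their unit part into ± e_{L-i+c}; so Y is also anti-block-triangular, with determinant
-- ± det(e) · V.

open import Defs
open import Algebra.Bundles using (CommutativeRing)
open import Relation.Binary.Bundles using (Setoid)
open import Level using (_⊔_)
open import Data.Empty using (⊥-elim)
open import Data.Fin using (Fin; toℕ; punchIn) renaming (zero to fzero; suc to fsuc)
import Data.Fin as Fin
import Data.Fin.Properties as Finₚ
open import Data.Nat using (ℕ; zero; suc; s≤s; s≤s⁻¹; z<s; s<s; _<_; _≤_; _∸_; _≟_; _<?_; _≤?_; _⊓_)
  renaming (_+_ to _+ℕ_; _*_ to _*ℕ_)
import Data.Nat.Properties as ℕₚ
open ℕₚ using (suc-injective)
open import Data.Nat.Tactic.RingSolver using (solve-∀)
open import Data.List using (List; []; _∷_; _++_; map; concatMap)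
open import Data.Product using (Σ; _×_; _,_; proj₁; proj₂; map₁)
open import Data.Sum using (inj₁; inj₂)
open import Data.Vec using (Vec; lookup; tabulate; replicate; zipWith)
import Data.Vec.Properties as Vecₚ
open import Function using (_∘_)
open import Relation.Binary.PropositionalEquality as ≡ using (_≡_; _≢_)
open import Relation.Nullary using (¬_; yes; no)

punchInℕ : ℕ → ℕ → ℕ
punchInℕ zero    s       = suc s
punchInℕ (suc j) zero    = zero
punchInℕ (suc j) (suc s) = suc (punchInℕ j s)

punchOutℕ : ℕ → ℕ → ℕ
punchOutℕ zero    zero    = zero
punchOutℕ zero    (suc c) = c
punchOutℕ (suc j) zero    = zero
punchOutℕ (suc j) (suc c) = suc (punchOutℕ j c)

toℕ-punchIn : ∀ {n} (j : Fin (suc n)) (s : Fin n) → toℕ (punchIn j s) ≡ punchInℕ (toℕ j) (toℕ s)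
toℕ-punchIn fzero    s        = ≡.refl
toℕ-punchIn (fsuc j) fzero    = ≡.refl
toℕ-punchIn (fsuc j) (fsuc s) = ≡.cong suc (toℕ-punchIn j s)

punchInℕ-< : ∀ {j s} → s < j → punchInℕ j s ≡ s
punchInℕ-< {suc j} {zero}  _         = ≡.refl
punchInℕ-< {suc j} {suc s} (s<s s<j) = ≡.cong suc (punchInℕ-< s<j)

punchInℕ-≥ : ∀ {j s} → j ≤ s → punchInℕ j s ≡ suc s
punchInℕ-≥ {zero}          _         = ≡.refl
punchInℕ-≥ {suc j} {suc s} (s≤s j≤s) = ≡.cong suc (punchInℕ-≥ j≤s)

punchInℕ-+ : ∀ n c → punchInℕ n (n +ℕ c) ≡ n +ℕ suc c
punchInℕ-+ n c = ≡.trans (punchInℕ-≥ (ℕₚ.m≤m+n n c)) (≡.sym (ℕₚ.+-suc n c))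

punchInℕ-shift : ∀ n c s → punchInℕ (n +ℕ c) (n +ℕ s) ≡ n +ℕ punchInℕ c s
punchInℕ-shift zero    c s = ≡.refl
punchInℕ-shift (suc n) c s = ≡.cong suc (punchInℕ-shift n c s)

punchInℕᵢ≢i : ∀ j s → punchInℕ j s ≢ j
punchInℕᵢ≢i (suc j) (suc s) eq = punchInℕᵢ≢i j s (suc-injective eq)

punchInℕ-injective : ∀ j {s t} → punchInℕ j s ≡ punchInℕ j t → s ≡ t
punchInℕ-injective zero                    eq = suc-injective eq
punchInℕ-injective (suc j) {zero}  {zero}  _  = ≡.refl
punchInℕ-injective (suc j) {suc s} {suc t} eq = ≡.cong suc (punchInℕ-injective j (suc-injective eq))

punchInℕ-bounded : ∀ {n j s} → j < suc n → s < n → punchInℕ j s < suc n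
punchInℕ-bounded {j = zero}                  _           s<n       = s<s s<n
punchInℕ-bounded {suc n} {suc j} {zero}      _           _         = z<s
punchInℕ-bounded {suc n} {suc j} {suc s}     (s<s j<1+n) (s<s s<n) = s<s (punchInℕ-bounded j<1+n s<n)

punchInℕ-punchOutℕ : ∀ {j c} → c ≢ j → punchInℕ j (punchOutℕ j c) ≡ c
punchInℕ-punchOutℕ {zero}  {zero}  c≢j = ⊥-elim (c≢j ≡.refl)
punchInℕ-punchOutℕ {zero}  {suc c} _   = ≡.refl
punchInℕ-punchOutℕ {suc j} {zero}  _   = ≡.refl
punchInℕ-punchOutℕ {suc j} {suc c} c≢j = ≡.cong suc (punchInℕ-punchOutℕ (c≢j ∘ ≡.cong suc))

punchOutℕ-punchInℕ : ∀ j s → punchOutℕ j (punchInℕ j s) ≡ s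
punchOutℕ-punchInℕ zero    s       = ≡.refl
punchOutℕ-punchInℕ (suc j) zero    = ≡.refl
punchOutℕ-punchInℕ (suc j) (suc s) = ≡.cong suc (punchOutℕ-punchInℕ j s)

punchOutℕ-bounded : ∀ {n j c} → j < suc n → c < suc n → c ≢ j → punchOutℕ j c < n
punchOutℕ-bounded {n}     {zero}  {zero}  _             _           c≢j = ⊥-elim (c≢j ≡.refl)
punchOutℕ-bounded {n}     {zero}  {suc c} _             (s<s c<n)   _   = c<n
punchOutℕ-bounded {zero}  {suc j}         (s<s ())      _           _
punchOutℕ-bounded {suc n} {suc j} {zero}  _             _           _   = z<s
punchOutℕ-bounded {suc n} {suc j} {suc c} (s<s j<1+n)   (s<s c<1+n) c≢j =
  s<s (punchOutℕ-bounded j<1+n c<1+n (c≢j ∘ ≡.cong suc))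

punchInℕ₂ : ℕ → ℕ → ℕ → ℕ
punchInℕ₂ a b c = punchInℕ a (punchInℕ (punchOutℕ a b) c)

punchInℕ₂-comm : ∀ {a b} c → a ≢ b → punchInℕ₂ a b c ≡ punchInℕ₂ b a c
punchInℕ₂-comm {zero}  {zero}  c       a≢b = ⊥-elim (a≢b ≡.refl)
punchInℕ₂-comm {zero}  {suc b} c       _   = ≡.refl
punchInℕ₂-comm {suc a} {zero}  c       _   = ≡.refl
punchInℕ₂-comm {suc a} {suc b} zero    _   = ≡.refl
punchInℕ₂-comm {suc a} {suc b} (suc c) a≢b = ≡.cong suc (punchInℕ₂-comm c (a≢b ∘ ≡.cong suc))

transposeSuc : ℕ → ℕ → ℕ
transposeSuc zero    zero          = 1
transposeSuc zero    (suc zero)    = 0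
transposeSuc zero    (suc (suc r)) = suc (suc r)
transposeSuc (suc i) zero          = zero
transposeSuc (suc i) (suc r)       = suc (transposeSuc i r)

transposeSuc-< : ∀ {i r} → r < i → transposeSuc i r ≡ r
transposeSuc-< {suc i} {zero}  _         = ≡.refl
transposeSuc-< {suc i} {suc r} (s<s r<i) = ≡.cong suc (transposeSuc-< r<i)

transposeSuc-self : ∀ i → transposeSuc i i ≡ suc i
transposeSuc-self zero    = ≡.refl
transposeSuc-self (suc i) = ≡.cong suc (transposeSuc-self i)

transposeSuc-punchIn : ∀ i k → transposeSuc i (punchInℕ i k) ≡ punchInℕ (suc i) k
transposeSuc-punchIn zero    zero    = ≡.refl
transposeSuc-punchIn zero    (suc k) = ≡.refl
transposeSuc-punchIn (suc i) zero    = ≡.refl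
transposeSuc-punchIn (suc i) (suc k) = ≡.cong suc (transposeSuc-punchIn i k)

skipBand : ℕ → ℕ → ℕ → ℕ
skipBand zero    m r       = m +ℕ r
skipBand (suc L) m zero    = zero
skipBand (suc L) m (suc r) = suc (skipBand L m r)

skipBand-empty : ∀ L r → skipBand L 0 r ≡ r
skipBand-empty zero    r       = ≡.refl
skipBand-empty (suc L) zero    = ≡.refl
skipBand-empty (suc L) (suc r) = ≡.cong suc (skipBand-empty L r)

skipBand-< : ∀ {L r} m → r < L → skipBand L m r ≡ r
skipBand-< {suc L} {zero}  m _         = ≡.refl
skipBand-< {suc L} {suc r} m (s<s r<L) = ≡.cong suc (skipBand-< m r<L)

skipBand-≥ : ∀ {L r} m → L ≤ r → skipBand L m r ≡ m +ℕ r
skipBand-≥ {zero}          m _         = ≡.refl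
skipBand-≥ {suc L} {suc r} m (s≤s L≤r) = ≡.trans (≡.cong suc (skipBand-≥ m L≤r)) (≡.sym (ℕₚ.+-suc m r))

punchInℕ-skipBand : ∀ L m r → punchInℕ L (skipBand L m r) ≡ skipBand L (suc m) r
punchInℕ-skipBand zero    m r       = ≡.refl
punchInℕ-skipBand (suc L) m zero    = ≡.refl
punchInℕ-skipBand (suc L) m (suc r) = ≡.cong suc (punchInℕ-skipBand L m r)

extend : ∀ {a} {A : Set a} {k} → (Fin k → A) → A → ℕ → A
extend {k = zero}  f d j       = d
extend {k = suc k} f d zero    = f fzero
extend {k = suc k} f d (suc j) = extend (f ∘ fsuc) d j

extend-toℕ : ∀ {a} {A : Set a} {k} (f : Fin k → A) d i → extend f d (toℕ i) ≡ f i
extend-toℕ f d fzero    = ≡.refl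
extend-toℕ f d (fsuc i) = extend-toℕ (f ∘ fsuc) d i

extend-∘ : ∀ {a b} {A : Set a} {B : Set b} {k} (h : A → B) (f : Fin k → A) d j →
           h (extend f d j) ≡ extend (h ∘ f) (h d) j
extend-∘ {k = zero}  h f d j       = ≡.refl
extend-∘ {k = suc k} h f d zero    = ≡.refl
extend-∘ {k = suc k} h f d (suc j) = extend-∘ h (f ∘ fsuc) d j

rectℕ : ℕ → ℕ → ℕ → ℕ
rectℕ m L r with r <? L
... | yes _ = m
... | no  _ = 0

exponent-below : ∀ m n r → (m +ℕ n) ∸ suc (m +ℕ r) ≡ n ∸ 1 ∸ r
exponent-below m n r = begin
  (m +ℕ n) ∸ suc (m +ℕ r)  ≡⟨ ≡.cong ((m +ℕ n) ∸_) (ℕₚ.+-suc m r) ⟨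
  (m +ℕ n) ∸ (m +ℕ suc r)  ≡⟨ ℕₚ.[m+n]∸[m+o]≡n∸o m n (suc r) ⟩
  n ∸ suc r                ≡⟨ ℕₚ.∸-+-assoc n 1 r ⟨
  n ∸ 1 ∸ r                ∎
  where open ≡.≡-Reasoning

exponent-skipBand : ∀ {L n} m r → r < n → (m +ℕ n) ∸ suc (skipBand L m r) ≡ rectℕ m L r +ℕ (n ∸ 1 ∸ r)
exponent-skipBand {L} {n} m r r<n with r <? L
... | yes r<L = begin
  (m +ℕ n) ∸ suc (skipBand L m r)  ≡⟨ ≡.cong (λ k → (m +ℕ n) ∸ suc k) (skipBand-< m r<L) ⟩
  (m +ℕ n) ∸ suc r                 ≡⟨ ℕₚ.+-∸-assoc m r<n ⟩
  m +ℕ (n ∸ suc r)                 ≡⟨ ≡.cong (m +ℕ_) (ℕₚ.∸-+-assoc n 1 r) ⟨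
  m +ℕ (n ∸ 1 ∸ r)                 ∎
  where open ≡.≡-Reasoning
... | no  r≮L = ≡.trans (≡.cong (λ k → (m +ℕ n) ∸ suc k) (skipBand-≥ m (ℕₚ.≮⇒≥ r≮L))) (exponent-below m n r)

exponent-shift : ∀ i Q n s → s ≤ n → (suc (i +ℕ Q) +ℕ n) ∸ suc (i +ℕ (n ∸ s)) ≡ Q +ℕ s
exponent-shift i Q n s s≤n = begin
  (suc (i +ℕ Q) +ℕ n) ∸ suc (i +ℕ (n ∸ s))               ≡⟨ ≡.cong (λ k → (suc (i +ℕ Q) +ℕ k) ∸ suc (i +ℕ (n ∸ s)))
                                                                   (ℕₚ.m∸n+n≡m s≤n) ⟨
  (suc (i +ℕ Q) +ℕ ((n ∸ s) +ℕ s)) ∸ suc (i +ℕ (n ∸ s))  ≡⟨ ≡.cong (_∸ suc (i +ℕ (n ∸ s))) (shuffle i Q (n ∸ s) s) ⟩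
  (suc (i +ℕ (n ∸ s)) +ℕ (Q +ℕ s)) ∸ suc (i +ℕ (n ∸ s))  ≡⟨ ℕₚ.m+n∸m≡n (suc (i +ℕ (n ∸ s))) (Q +ℕ s) ⟩
  Q +ℕ s                                                  ∎
  where
  open ≡.≡-Reasoning
  shuffle : ∀ i Q t s → suc (i +ℕ Q) +ℕ (t +ℕ s) ≡ suc (i +ℕ t) +ℕ (Q +ℕ s)
  shuffle = solve-∀

unit-row-sum : ∀ L off i {s} → s ≤ L +ℕ off → (i +ℕ (L +ℕ off ∸ s)) +ℕ s ≡ L +ℕ (off +ℕ i)
unit-row-sum L off i s≤n =
  ≡.trans (ℕₚ.+-assoc i _ _) (≡.trans (≡.cong (i +ℕ_) (ℕₚ.m∸n+n≡m s≤n)) (shuffle i L off))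
  where
  shuffle : ∀ i L off → i +ℕ (L +ℕ off) ≡ L +ℕ (off +ℕ i)
  shuffle = solve-∀

+-rotate : ∀ L s c → L +ℕ (s +ℕ c) ≡ (L +ℕ c) +ℕ s
+-rotate = solve-∀

unit-row-solve : ∀ {L off i c s} → s ≤ L +ℕ off → i +ℕ (L +ℕ off ∸ s) ≡ L +ℕ c → s +ℕ c ≡ off +ℕ i
unit-row-solve {L} {off} {i} {c} {s} s≤n hit = ℕₚ.+-cancelˡ-≡ L _ _
  (≡.trans (+-rotate L s c) (≡.trans (≡.cong (_+ℕ s) (≡.sym hit)) (unit-row-sum L off i s≤n)))

unit-row-hit : ∀ {L off i c s} → s ≤ L +ℕ off → s +ℕ c ≡ off +ℕ i → i +ℕ (L +ℕ off ∸ s) ≡ L +ℕ c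
unit-row-hit {L} {off} {i} {c} {s} s≤n solved = ℕₚ.+-cancelʳ-≡ s _ _
  (≡.trans (unit-row-sum L off i s≤n) (≡.trans (≡.cong (L +ℕ_) (≡.sym solved)) (+-rotate L s c)))

module Determinant {c ℓ} (R : CommutativeRing c ℓ) where
  open CommutativeRing R hiding (zero)
  open RingOps rawRing using (sign; pow; ΣF) renaming (det to detFin)
  open import Algebra.Properties.Ring ring using (-‿distribˡ-*; -‿distribʳ-*; -‿involutive; -0#≈0#; -‿+-comm)
  open import Algebra.Properties.CommutativeSemigroup +-commutativeSemigroup
    using () renaming (interchange to +-interchange; x∙yz≈y∙xz to x+yz≈y+xz)
  open import Algebra.Properties.CommutativeSemigroup *-commutativeSemigroup
    using (x∙yz≈y∙xz) renaming (interchange to *-interchange)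
  open import Algebra.Solver.CommutativeMonoid *-commutativeMonoid using (solve; _⊜_) renaming (_⊕_ to _⊗_)
  open import Relation.Binary.Reasoning.Setoid setoid

  -- Opaque, so that bounds and summands of sums can be recovered from goals by unification.
  opaque
    ∑ : ℕ → (ℕ → Carrier) → Carrier
    ∑ zero    g = 0#
    ∑ (suc n) g = g 0 + ∑ n (λ i → g (suc i))

    ∏ : ℕ → (ℕ → Carrier) → Carrier
    ∏ zero    g = 1#
    ∏ (suc n) g = g 0 * ∏ n (λ i → g (suc i))

  infixl 10 ∑ ∏
  syntax ∑ n (λ i → x) = ∑[ i < n ] x
  syntax ∏ n (λ i → x) = ∏[ i < n ] x

  opaque
    unfolding ∑ ∏

    ∑-empty : ∀ g → ∑ 0 g ≡ 0#
    ∑-empty g = ≡.refl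

    ∑-suc : ∀ n g → ∑ (suc n) g ≡ g 0 + ∑[ i < n ] g (suc i)
    ∑-suc n g = ≡.refl

    ∑-cong : ∀ {n g h} → (∀ i → i < n → g i ≈ h i) → ∑ n g ≈ ∑ n h
    ∑-cong {zero}  _  = refl
    ∑-cong {suc n} eq = +-cong (eq 0 z<s) (∑-cong {n} λ i i<n → eq (suc i) (s<s i<n))

    ∑-zero : ∀ {n g} → (∀ i → i < n → g i ≈ 0#) → ∑ n g ≈ 0#
    ∑-zero {zero}  _  = refl
    ∑-zero {suc n} eq = trans (+-cong (eq 0 z<s) (∑-zero {n} λ i i<n → eq (suc i) (s<s i<n))) (+-identityˡ 0#)

    ∑-distrib-+ : ∀ n g h → ∑[ i < n ] (g i + h i) ≈ ∑ n g + ∑ n h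
    ∑-distrib-+ zero    g h = sym (+-identityˡ 0#)
    ∑-distrib-+ (suc n) g h = trans (+-congˡ (∑-distrib-+ n (g ∘ suc) (h ∘ suc))) (+-interchange _ _ _ _)

    *-distribˡ-∑ : ∀ x n g → x * ∑ n g ≈ ∑[ i < n ] (x * g i)
    *-distribˡ-∑ x zero    g = zeroʳ x
    *-distribˡ-∑ x (suc n) g = trans (distribˡ x _ _) (+-congˡ (*-distribˡ-∑ x n (g ∘ suc)))

    -‿distrib-∑ : ∀ n g → - ∑ n g ≈ ∑[ i < n ] (- g i)
    -‿distrib-∑ zero    g = -0#≈0#
    -‿distrib-∑ (suc n) g = trans (sym (-‿+-comm _ _)) (+-congˡ (-‿distrib-∑ n (g ∘ suc)))

    ∑-comm : ∀ m n (f : ℕ → ℕ → Carrier) → ∑[ i < m ] ∑ n (f i) ≈ ∑[ j < n ] ∑[ i < m ] f i j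
    ∑-comm zero    n f = sym (∑-zero {n} λ _ _ → refl)
    ∑-comm (suc m) n f =
      trans (+-congˡ (∑-comm m n (f ∘ suc))) (sym (∑-distrib-+ n (f 0) λ j → ∑[ i < m ] f (suc i) j))

    ∑-split : ∀ m n g → ∑ (m +ℕ n) g ≈ ∑ m g + ∑[ i < n ] g (m +ℕ i)
    ∑-split zero    n g = sym (+-identityˡ _)
    ∑-split (suc m) n g = trans (+-congˡ (∑-split m n (g ∘ suc))) (sym (+-assoc _ _ _))

    ∑-init-last : ∀ n g → ∑ (suc n) g ≈ ∑ n g + g n
    ∑-init-last zero    g = +-comm (g 0) 0#
    ∑-init-last (suc n) g = trans (+-congˡ (∑-init-last n (g ∘ suc))) (sym (+-assoc _ _ _))

    ∑-remove : ∀ {n j} g → j < suc n → ∑ (suc n) g ≈ g j + ∑ n (g ∘ punchInℕ j)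
    ∑-remove {j = zero}      g _           = refl
    ∑-remove {zero} {suc j}  g (s<s ())
    ∑-remove {suc n} {suc j} g (s<s j<1+n) = trans (+-congˡ (∑-remove (g ∘ suc) j<1+n)) (x+yz≈y+xz _ _ _)

    ∏-empty : ∀ g → ∏ 0 g ≡ 1#
    ∏-empty g = ≡.refl

    ∏-suc : ∀ n g → ∏ (suc n) g ≡ g 0 * ∏[ i < n ] g (suc i)
    ∏-suc n g = ≡.refl

    ∏-cong : ∀ {n g h} → (∀ i → i < n → g i ≈ h i) → ∏ n g ≈ ∏ n h
    ∏-cong {zero}  _  = refl
    ∏-cong {suc n} eq = *-cong (eq 0 z<s) (∏-cong {n} λ i i<n → eq (suc i) (s<s i<n))

    ∏-distrib-* : ∀ n g h → ∏ n (λ i → g i * h i) ≈ ∏ n g * ∏ n h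
    ∏-distrib-* zero    g h = sym (*-identityˡ 1#)
    ∏-distrib-* (suc n) g h = trans (*-congˡ (∏-distrib-* n (g ∘ suc) (h ∘ suc))) (*-interchange _ _ _ _)

    ∏-remove : ∀ {n j} g → j < suc n → ∏ (suc n) g ≈ g j * ∏ n (g ∘ punchInℕ j)
    ∏-remove {j = zero}      g _           = refl
    ∏-remove {zero} {suc j}  g (s<s ())
    ∏-remove {suc n} {suc j} g (s<s j<1+n) = trans (*-congˡ (∏-remove (g ∘ suc) j<1+n)) (x∙yz≈y∙xz _ _ _)

    ∏-ones : ∀ {n g} → (∀ i → i < n → g i ≈ 1#) → ∏ n g ≈ 1#
    ∏-ones {zero}  _  = refl
    ∏-ones {suc n} eq = trans (*-cong (eq 0 z<s) (∏-ones {n} λ i i<n → eq (suc i) (s<s i<n))) (*-identityˡ 1#)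

    ∏-const : ∀ n x → ∏ n (λ _ → x) ≈ pow x n
    ∏-const zero    x = refl
    ∏-const (suc n) x = *-congˡ (∏-const n x)

  *-distribʳ-∑ : ∀ x n g → ∑ n g * x ≈ ∑[ i < n ] (g i * x)
  *-distribʳ-∑ x n g = trans (*-comm _ x) (trans (*-distribˡ-∑ x n g) (∑-cong λ i _ → *-comm x (g i)))

  ∑-single : ∀ {n j} g → j < n → (∀ i → i < n → i ≢ j → g i ≈ 0#) → ∑ n g ≈ g j
  ∑-single {suc n} {j} g j<1+n others = begin
    ∑ (suc n) g                 ≈⟨ ∑-remove g j<1+n ⟩
    g j + ∑ n (g ∘ punchInℕ j)  ≈⟨ +-congˡ (∑-zero λ i i<n →
                                     others _ (punchInℕ-bounded j<1+n i<n) (punchInℕᵢ≢i j i)) ⟩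
    g j + 0#                    ≈⟨ +-identityʳ _ ⟩
    g j                         ∎

  ∑∑-antisym : ∀ n (T : ℕ → ℕ → Carrier) → (∀ a b → T a b ≈ - T b a) → (∀ a → T a a ≈ 0#) →
               ∑[ a < n ] ∑ n (T a) ≈ 0#
  ∑∑-antisym zero    T anti diag = reflexive (∑-empty _)
  ∑∑-antisym (suc n) T anti diag = begin
    ∑[ a < suc n ] ∑ (suc n) (T a)
      ≈⟨ trans (reflexive (∑-suc n _)) (+-cong (reflexive (∑-suc n _)) (∑-cong λ a _ → reflexive (∑-suc n _))) ⟩
    (T 0 0 + ∑ n row₀) + ∑[ a < n ] (T (suc a) 0 + ∑ n (T (suc a) ∘ suc))
      ≈⟨ +-cong (+-congʳ (diag 0)) (∑-distrib-+ n col₀ _) ⟩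
    (0# + ∑ n row₀) + (∑ n col₀ + ∑[ a < n ] ∑ n (T (suc a) ∘ suc))
      ≈⟨ +-cong (+-identityˡ _) (+-congˡ (∑∑-antisym n _ (λ a b → anti (suc a) (suc b)) (diag ∘ suc))) ⟩
    ∑ n row₀ + (∑ n col₀ + 0#)     ≈⟨ +-congˡ (+-identityʳ _) ⟩
    ∑ n row₀ + ∑ n col₀            ≈⟨ sym (∑-distrib-+ n row₀ col₀) ⟩
    ∑[ b < n ] (row₀ b + col₀ b)  ≈⟨ ∑-zero (λ b _ → trans (+-congʳ (anti 0 (suc b))) (-‿inverseˡ _)) ⟩
    0#                             ∎
    where
    row₀ col₀ : ℕ → Carrier
    row₀ b = T 0 (suc b)
    col₀ a = T (suc a) 0

  -x*-y≈x*y : ∀ x y → - x * - y ≈ x * y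
  -x*-y≈x*y x y = trans (sym (-‿distribˡ-* x (- y))) (trans (-‿cong (sym (-‿distribʳ-* x y))) (-‿involutive _))

  x*[y*0]≈0 : ∀ x y → x * (y * 0#) ≈ 0#
  x*[y*0]≈0 x y = trans (*-congˡ (zeroʳ y)) (zeroʳ x)

  sign-+ : ∀ a b → sign (a +ℕ b) ≈ sign a * sign b
  sign-+ zero    b = sym (*-identityˡ _)
  sign-+ (suc a) b = trans (-‿cong (sign-+ a b)) (-‿distribˡ-* _ _)

  sign-square : ∀ a → sign a * sign a ≈ 1#
  sign-square zero    = *-identityˡ 1#
  sign-square (suc a) = trans (-x*-y≈x*y _ _) (sign-square a)

  sign-double : ∀ a → sign (a +ℕ a) ≈ 1#
  sign-double a = trans (sign-+ a a) (sign-square a)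

  pow-+ : ∀ x p q → pow x (p +ℕ q) ≈ pow x p * pow x q
  pow-+ x zero    q = sym (*-identityˡ _)
  pow-+ x (suc p) q = trans (*-congˡ (pow-+ x p q)) (sym (*-assoc _ _ _))

  pow-neg : ∀ x s → pow (- x) s ≈ sign s * pow x s
  pow-neg x zero    = sym (*-identityˡ _)
  pow-neg x (suc s) = begin
    - x * pow (- x) s         ≈⟨ *-congˡ (pow-neg x s) ⟩
    - x * (sign s * pow x s)  ≈⟨ sym (-‿distribˡ-* _ _) ⟩
    - (x * (sign s * pow x s)) ≈⟨ -‿cong (x∙yz≈y∙xz _ _ _) ⟩
    - (sign s * (x * pow x s)) ≈⟨ -‿distribˡ-* _ _ ⟩
    - sign s * (x * pow x s)  ∎

  pow-sign : ∀ k m → pow (sign k) m ≈ sign (m *ℕ k)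
  pow-sign k zero    = refl
  pow-sign k (suc m) = trans (*-congˡ (pow-sign k m)) (sym (sign-+ k (m *ℕ k)))

  opaque
    δ : ℕ → ℕ → Carrier
    δ a b with a ≟ b
    ... | yes _ = 1#
    ... | no  _ = 0#

    δ-refl : ∀ a → δ a a ≈ 1#
    δ-refl a with a ≟ a
    ... | yes _   = refl
    ... | no  a≢a = ⊥-elim (a≢a ≡.refl)

    δ-≢ : ∀ {a b} → a ≢ b → δ a b ≈ 0#
    δ-≢ {a} {b} a≢b with a ≟ b
    ... | yes a≡b = ⊥-elim (a≢b a≡b)
    ... | no  _   = refl

  δ-punchIn : ∀ j a b → δ (punchInℕ j a) (punchInℕ j b) ≈ δ a b
  δ-punchIn j a b with a ≟ b
  ... | yes ≡.refl = trans (δ-refl (punchInℕ j a)) (sym (δ-refl a))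
  ... | no  a≢b    = trans (δ-≢ (a≢b ∘ punchInℕ-injective j)) (sym (δ-≢ a≢b))

  -- Matrices are indexed by ℕ; det n only reads the entries with both indices below n.
  Matrix : Set c
  Matrix = ℕ → ℕ → Carrier

  minor : ℕ → Matrix → Matrix
  minor j f r s = f (suc r) (punchInℕ j s)

  det : ℕ → Matrix → Carrier
  det zero    f = 1#
  det (suc n) f = ∑[ j < suc n ] (sign j * (f 0 j * det n (minor j f)))

  det-cong : ∀ n {f g} → (∀ r s → r < n → s < n → f r s ≈ g r s) → det n f ≈ det n g
  det-cong zero    _  = refl
  det-cong (suc n) eq = ∑-cong λ j j<1+n → *-congˡ (*-cong (eq 0 j z<s j<1+n) (det-cong n λ r s r<n s<n →
    eq (suc r) (punchInℕ j s) (s<s r<n) (punchInℕ-bounded j<1+n s<n)))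

  ΣF≈∑ : ∀ {n} (g : Fin n → Carrier) h → (∀ i → g i ≈ h (toℕ i)) → ΣF g ≈ ∑ n h
  ΣF≈∑ {zero}  g h eq = reflexive (≡.sym (∑-empty h))
  ΣF≈∑ {suc n} g h eq =
    trans (+-cong (eq fzero) (ΣF≈∑ (g ∘ fsuc) (h ∘ suc) (eq ∘ fsuc))) (reflexive (≡.sym (∑-suc n h)))

  detFin≈det : ∀ {n} (M : Fin n → Fin n → Carrier) f → (∀ r s → M r s ≈ f (toℕ r) (toℕ s)) → detFin M ≈ det n f
  detFin≈det {zero}  M f eq = refl
  detFin≈det {suc n} M f eq = ΣF≈∑ _ _ λ j → *-congˡ (*-cong (eq fzero j) (detFin≈det _ (minor (toℕ j) f) λ r s →
    trans (eq (fsuc r) (punchIn j s)) (reflexive (≡.cong (f (suc (toℕ r))) (toℕ-punchIn j s)))))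

  det-row-linear : ∀ {n i f g h} → i < n →
                   (∀ r c → r ≢ i → g r c ≈ f r c) → (∀ r c → r ≢ i → h r c ≈ f r c) →
                   (∀ c → f i c ≈ g i c + h i c) → det n f ≈ det n g + det n h
  det-row-linear {suc n} {zero} {f} {g} {h} _ g≈f h≈f f₀ = trans (∑-cong term) (∑-distrib-+ (suc n) _ _)
    where
    same : ∀ {g} → (∀ r c → r ≢ 0 → g r c ≈ f r c) → ∀ j → det n (minor j f) ≈ det n (minor j g)
    same g≈f j = det-cong n λ r s _ _ → sym (g≈f (suc r) _ λ ())
    term : ∀ j → j < suc n → sign j * (f 0 j * det n (minor j f)) ≈
                             sign j * (g 0 j * det n (minor j g)) + sign j * (h 0 j * det n (minor j h))
    term j _ = begin
      sign j * (f 0 j * det n (minor j f))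
        ≈⟨ *-congˡ (trans (*-congʳ (f₀ j)) (distribʳ _ _ _)) ⟩
      sign j * (g 0 j * det n (minor j f) + h 0 j * det n (minor j f))
        ≈⟨ distribˡ _ _ _ ⟩
      sign j * (g 0 j * det n (minor j f)) + sign j * (h 0 j * det n (minor j f))
        ≈⟨ +-cong (*-congˡ (*-congˡ (same g≈f j))) (*-congˡ (*-congˡ (same h≈f j))) ⟩
      sign j * (g 0 j * det n (minor j g)) + sign j * (h 0 j * det n (minor j h)) ∎
  det-row-linear {suc n} {suc i} {f} {g} {h} (s<s i<n) g≈f h≈f fᵢ = trans (∑-cong term) (∑-distrib-+ (suc n) _ _)
    where
    term : ∀ j → j < suc n → sign j * (f 0 j * det n (minor j f)) ≈
                             sign j * (g 0 j * det n (minor j g)) + sign j * (h 0 j * det n (minor j h))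
    term j _ = begin
      sign j * (f 0 j * det n (minor j f))
        ≈⟨ *-congˡ (*-congˡ (det-row-linear i<n (λ r c r≢i → g≈f (suc r) _ (r≢i ∘ suc-injective))
                                                (λ r c r≢i → h≈f (suc r) _ (r≢i ∘ suc-injective)) (fᵢ ∘ _))) ⟩
      sign j * (f 0 j * (det n (minor j g) + det n (minor j h)))
        ≈⟨ trans (*-congˡ (distribˡ _ _ _)) (distribˡ _ _ _) ⟩
      sign j * (f 0 j * det n (minor j g)) + sign j * (f 0 j * det n (minor j h))
        ≈⟨ +-cong (*-congˡ (*-congʳ (sym (g≈f 0 j λ ())))) (*-congˡ (*-congʳ (sym (h≈f 0 j λ ())))) ⟩
      sign j * (g 0 j * det n (minor j g)) + sign j * (h 0 j * det n (minor j h)) ∎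

  det-row-scale : ∀ {n i f g} κ → i < n → (∀ r c → r ≢ i → f r c ≈ g r c) → (∀ c → f i c ≈ κ * g i c) →
                  det n f ≈ κ * det n g
  det-row-scale {suc n} {zero} {f} {g} κ _ f≈g f₀ = trans (∑-cong term) (sym (*-distribˡ-∑ κ (suc n) _))
    where
    term : ∀ j → j < suc n → sign j * (f 0 j * det n (minor j f)) ≈ κ * (sign j * (g 0 j * det n (minor j g)))
    term j _ = trans (*-congˡ (trans (*-cong (f₀ j) (det-cong n λ r s _ _ → f≈g (suc r) _ λ ())) (*-assoc _ _ _)))
                     (x∙yz≈y∙xz _ _ _)
  det-row-scale {suc n} {suc i} {f} {g} κ (s<s i<n) f≈g fᵢ = trans (∑-cong term) (sym (*-distribˡ-∑ κ (suc n) _))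
    where
    term : ∀ j → j < suc n → sign j * (f 0 j * det n (minor j f)) ≈ κ * (sign j * (g 0 j * det n (minor j g)))
    term j _ = trans (*-congˡ (trans (*-cong (f≈g 0 j λ ()) (det-row-scale κ i<n
                       (λ r c r≢i → f≈g (suc r) _ (r≢i ∘ suc-injective)) (fᵢ ∘ _))) (x∙yz≈y∙xz _ _ _)))
                     (x∙yz≈y∙xz _ _ _)

  pairSign : ℕ → ℕ → Carrier
  pairSign a b = sign a * sign (punchOutℕ a b)

  pairSign-anti : ∀ {a b} → a ≢ b → pairSign a b ≈ - pairSign b a
  pairSign-anti {zero}  {zero}  a≢b = ⊥-elim (a≢b ≡.refl)
  pairSign-anti {zero}  {suc b} _   = begin
    1# * sign b          ≈⟨ *-identityˡ _ ⟩
    sign b               ≈⟨ sym (-‿involutive _) ⟩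
    - - sign b           ≈⟨ -‿cong (sym (*-identityʳ _)) ⟩
    - (- sign b * 1#)    ∎
  pairSign-anti {suc a} {zero}  _   = trans (*-identityʳ _) (-‿cong (sym (*-identityˡ _)))
  pairSign-anti {suc a} {suc b} a≢b =
    trans (-x*-y≈x*y _ _) (trans (pairSign-anti (a≢b ∘ ≡.cong suc)) (-‿cong (sym (-x*-y≈x*y _ _))))

  pairTerm : ℕ → Matrix → ℕ → ℕ → Carrier
  pairTerm n f a b with a ≟ b
  ... | yes _ = 0#
  ... | no  _ = pairSign a b * (f 0 a * (f 1 b * det n (λ r s → f (suc (suc r)) (punchInℕ₂ a b s))))

  pairTerm-diag : ∀ n f a → pairTerm n f a a ≈ 0#
  pairTerm-diag n f a with a ≟ a
  ... | yes _   = refl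
  ... | no  a≢a = ⊥-elim (a≢a ≡.refl)

  pairTerm-≢ : ∀ n f {a b} → a ≢ b →
                 pairTerm n f a b ≈ pairSign a b * (f 0 a * (f 1 b * det n (λ r s → f (suc (suc r)) (punchInℕ₂ a b s))))
  pairTerm-≢ n f {a} {b} a≢b with a ≟ b
  ... | yes a≡b = ⊥-elim (a≢b a≡b)
  ... | no  _   = refl

  det-expand₂ : ∀ n f → det (suc (suc n)) f ≈ ∑[ a < suc (suc n) ] ∑[ b < suc (suc n) ] pairTerm n f a b
  det-expand₂ n f = ∑-cong λ a a<2+n → sym (row a a<2+n)
    where
    row : ∀ a → a < suc (suc n) →
          ∑[ b < suc (suc n) ] pairTerm n f a b ≈ sign a * (f 0 a * det (suc n) (minor a f))
    row a a<2+n = begin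
      ∑[ b < suc (suc n) ] pairTerm n f a b
        ≈⟨ ∑-remove _ a<2+n ⟩
      pairTerm n f a a + ∑[ j < suc n ] pairTerm n f a (punchInℕ a j)
        ≈⟨ +-cong (pairTerm-diag n f a) (∑-cong λ j _ → term j) ⟩
      0# + ∑[ j < suc n ] (sign a * (f 0 a * (sign j * (f 1 (punchInℕ a j) * det n (minor j (minor a f))))))
        ≈⟨ +-identityˡ _ ⟩
      ∑[ j < suc n ] (sign a * (f 0 a * (sign j * (f 1 (punchInℕ a j) * det n (minor j (minor a f))))))
        ≈⟨ sym (trans (*-congˡ (*-distribˡ-∑ _ _ _)) (*-distribˡ-∑ _ _ _)) ⟩
      sign a * (f 0 a * det (suc n) (minor a f)) ∎
      where
      term : ∀ j → pairTerm n f a (punchInℕ a j) ≈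
                   sign a * (f 0 a * (sign j * (f 1 (punchInℕ a j) * det n (minor j (minor a f)))))
      term j = begin
        pairTerm n f a (punchInℕ a j)
          ≈⟨ pairTerm-≢ n f (punchInℕᵢ≢i a j ∘ ≡.sym) ⟩
        pairSign a (punchInℕ a j) *
          (f 0 a * (f 1 (punchInℕ a j) * det n (λ r s → f (suc (suc r)) (punchInℕ₂ a (punchInℕ a j) s))))
          ≡⟨ ≡.cong (λ k → (sign a * sign k) * (f 0 a * (f 1 (punchInℕ a j) *
                                det n (λ r s → f (suc (suc r)) (punchInℕ a (punchInℕ k s))))))
                    (punchOutℕ-punchInℕ a j) ⟩
        (sign a * sign j) * (f 0 a * (f 1 (punchInℕ a j) * det n (minor j (minor a f))))
          ≈⟨ trans (*-assoc _ _ _) (*-congˡ (x∙yz≈y∙xz _ _ _)) ⟩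
        sign a * (f 0 a * (sign j * (f 1 (punchInℕ a j) * det n (minor j (minor a f))))) ∎

  pairTerm-swap : ∀ n {f g} → (∀ c → g 0 c ≈ f 1 c) → (∀ c → g 1 c ≈ f 0 c) →
                  (∀ r c → g (suc (suc r)) c ≈ f (suc (suc r)) c) → ∀ a b → pairTerm n g a b ≈ - pairTerm n f b a
  pairTerm-swap n {f} {g} g₀ g₁ g₂ a b with a ≟ b
  ... | yes ≡.refl = sym (trans (-‿cong (pairTerm-diag n f a)) -0#≈0#)
  ... | no  a≢b    = begin
    pairSign a b * (g 0 a * (g 1 b * det n (λ r s → g (suc (suc r)) (punchInℕ₂ a b s))))
      ≈⟨ *-cong (pairSign-anti a≢b) (*-cong (g₀ a) (*-cong (g₁ b) (det-cong n λ r s _ _ →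
           trans (g₂ r _) (reflexive (≡.cong (f (suc (suc r))) (punchInℕ₂-comm s a≢b)))))) ⟩
    - pairSign b a * (f 1 a * (f 0 b * det n (λ r s → f (suc (suc r)) (punchInℕ₂ b a s))))
      ≈⟨ sym (-‿distribˡ-* _ _) ⟩
    - (pairSign b a * (f 1 a * (f 0 b * det n (λ r s → f (suc (suc r)) (punchInℕ₂ b a s)))))
      ≈⟨ -‿cong (*-congˡ (x∙yz≈y∙xz _ _ _)) ⟩
    - (pairSign b a * (f 0 b * (f 1 a * det n (λ r s → f (suc (suc r)) (punchInℕ₂ b a s)))))
      ≈⟨ -‿cong (sym (pairTerm-≢ n f (a≢b ∘ ≡.sym))) ⟩
    - pairTerm n f b a ∎

  det-swap₀₁ : ∀ n f → det (suc (suc n)) (f ∘ transposeSuc 0) ≈ - det (suc (suc n)) f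
  det-swap₀₁ n f = begin
    det N (f ∘ transposeSuc 0)                  ≈⟨ det-expand₂ n _ ⟩
    ∑[ a < N ] ∑[ b < N ] pairTerm n (f ∘ transposeSuc 0) a b
      ≈⟨ ∑-cong (λ a _ → ∑-cong λ b _ → pairTerm-swap n (λ _ → refl) (λ _ → refl) (λ _ _ → refl) a b) ⟩
    ∑[ a < N ] ∑[ b < N ] (- pairTerm n f b a)  ≈⟨ ∑-cong (λ a _ → sym (-‿distrib-∑ N _)) ⟩
    ∑[ a < N ] (- ∑[ b < N ] pairTerm n f b a)  ≈⟨ sym (-‿distrib-∑ N _) ⟩
    - ∑[ a < N ] ∑[ b < N ] pairTerm n f b a    ≈⟨ -‿cong (∑-comm N N _) ⟩
    - ∑[ b < N ] ∑[ a < N ] pairTerm n f b a    ≈⟨ -‿cong (sym (det-expand₂ n f)) ⟩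
    - det N f                                   ∎
    where
    N : ℕ
    N = suc (suc n)

  det-equal₀₁ : ∀ n f → (∀ c → f 0 c ≈ f 1 c) → det (suc (suc n)) f ≈ 0#
  det-equal₀₁ n f eq = trans (det-expand₂ n f)
    (∑∑-antisym _ (pairTerm n f) (pairTerm-swap n eq (sym ∘ eq) (λ _ _ → refl)) (pairTerm-diag n f))

  det-swap-adjacent : ∀ {n} i f → suc i < n → det n (f ∘ transposeSuc i) ≈ - det n f
  det-swap-adjacent {suc zero}    zero    f (s<s ())
  det-swap-adjacent {suc (suc n)} zero    f _               = det-swap₀₁ n f
  det-swap-adjacent {suc n}       (suc i) f (s<s i+1<n) = begin
    ∑[ j < suc n ] (sign j * (f 0 j * det n (minor j f ∘ transposeSuc i)))
      ≈⟨ ∑-cong (λ j _ → *-congˡ (*-congˡ (det-swap-adjacent i (minor j f) i+1<n))) ⟩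
    ∑[ j < suc n ] (sign j * (f 0 j * - det n (minor j f)))
      ≈⟨ ∑-cong (λ j _ → trans (*-congˡ (sym (-‿distribʳ-* _ _))) (sym (-‿distribʳ-* _ _))) ⟩
    ∑[ j < suc n ] (- (sign j * (f 0 j * det n (minor j f))))
      ≈⟨ sym (-‿distrib-∑ (suc n) _) ⟩
    - det (suc n) f ∎

  det-equal-adjacent : ∀ {n} i f → suc i < n → (∀ c → f i c ≈ f (suc i) c) → det n f ≈ 0#
  det-equal-adjacent {suc zero}    zero    f (s<s ())
  det-equal-adjacent {suc (suc n)} zero    f _           eq = det-equal₀₁ n f eq
  det-equal-adjacent {suc n}       (suc i) f (s<s i+1<n) eq = ∑-zero λ j _ →
    trans (*-congˡ (*-congˡ (det-equal-adjacent i (minor j f) i+1<n (eq ∘ _)))) (x*[y*0]≈0 _ _)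

  det-equal-rows : ∀ {n i j} f → i < j → j < n → (∀ c → f i c ≈ f j c) → det n f ≈ 0#
  det-equal-rows {n} {i} {suc j} f (s≤s i≤j) j+1<n eq with ℕₚ.m≤n⇒m<n∨m≡n i≤j
  ... | inj₂ ≡.refl = det-equal-adjacent i f j+1<n eq
  ... | inj₁ i<j    = begin
    det n f                        ≈⟨ sym (-‿involutive _) ⟩
    - - det n f                    ≈⟨ -‿cong (sym (det-swap-adjacent j f j+1<n)) ⟩
    - det n (f ∘ transposeSuc j)   ≈⟨ -‿cong (det-equal-rows _ i<j (ℕₚ.<-trans (ℕₚ.n<1+n j) j+1<n) eq′) ⟩
    - 0#                           ≈⟨ -0#≈0# ⟩
    0#                             ∎
    where
    eq′ : ∀ c → f (transposeSuc j i) c ≈ f (transposeSuc j j) c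
    eq′ c = begin
      f (transposeSuc j i) c  ≡⟨ ≡.cong (λ r → f r c) (transposeSuc-< i<j) ⟩
      f i c                   ≈⟨ eq c ⟩
      f (suc j) c             ≡⟨ ≡.cong (λ r → f r c) (transposeSuc-self j) ⟨
      f (transposeSuc j j) c  ∎

  setRow : ℕ → (ℕ → Carrier) → Matrix → Matrix
  setRow zero    u f zero    = u
  setRow zero    u f (suc r) = f (suc r)
  setRow (suc i) u f zero    = f zero
  setRow (suc i) u f (suc r) = setRow i u (f ∘ suc) r

  setRow-≡ : ∀ i u f → setRow i u f i ≡ u
  setRow-≡ zero    u f = ≡.refl
  setRow-≡ (suc i) u f = setRow-≡ i u (f ∘ suc)

  setRow-≢ : ∀ {i r} u f → r ≢ i → setRow i u f r ≡ f r
  setRow-≢ {zero}  {zero}  u f r≢i = ⊥-elim (r≢i ≡.refl)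
  setRow-≢ {zero}  {suc r} u f _   = ≡.refl
  setRow-≢ {suc i} {zero}  u f _   = ≡.refl
  setRow-≢ {suc i} {suc r} u f r≢i = setRow-≢ u (f ∘ suc) (r≢i ∘ ≡.cong suc)

  det-row-combination : ∀ {n i} K (α : ℕ → Carrier) (ρ : ℕ → ℕ) f → i < n → (∀ s → s < K → i < ρ s × ρ s < n) →
                        det n (setRow i (λ c → ∑[ s < K ] (α s * f (ρ s) c)) f) ≈ 0#
  det-row-combination {n} {i} zero α ρ f i<n _ = begin
    det n (setRow i (λ c → ∑ 0 (λ s → α s * f (ρ s) c)) f)
      ≈⟨ det-row-scale 0# i<n (λ r c r≢i → reflexive (≡.cong-app (setRow-≢ _ f r≢i) c))
                             (λ c → trans (reflexive (≡.cong-app (setRow-≡ i _ f) c))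
                                          (trans (reflexive (∑-empty _)) (sym (zeroˡ (f i c))))) ⟩
    0# * det n f  ≈⟨ zeroˡ _ ⟩
    0#            ∎
  det-row-combination {n} {i} (suc K) α ρ f i<n bounds = begin
    det n (setRow i W f)
      ≈⟨ det-row-linear i<n (others _ _) (others _ _) (λ c →
           trans (row-i W c) (trans (reflexive (∑-suc K _)) (+-cong (sym (row-i W₀ c)) (sym (row-i W′ c))))) ⟩
    det n (setRow i W₀ f) + det n (setRow i W′ f)
      ≈⟨ +-cong (det-row-scale (α 0) i<n (others _ _) λ c → trans (row-i W₀ c) (*-congˡ (sym (row-i (f (ρ 0)) c))))
                (det-row-combination K (α ∘ suc) (ρ ∘ suc) f i<n (λ s s<K → bounds (suc s) (s<s s<K))) ⟩
    α 0 * det n (setRow i (f (ρ 0)) f) + 0#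
      ≈⟨ +-congʳ (*-congˡ (det-equal-rows _ i<ρ₀ ρ₀<n λ c →
           trans (row-i (f (ρ 0)) c) (sym (reflexive (≡.cong-app (setRow-≢ _ f (ℕₚ.<⇒≢ i<ρ₀ ∘ ≡.sym)) c))))) ⟩
    α 0 * 0# + 0#
      ≈⟨ trans (+-identityʳ _) (zeroʳ _) ⟩
    0# ∎
    where
    W W₀ W′ : ℕ → Carrier
    W  c = ∑[ s < suc K ] (α s * f (ρ s) c)
    W₀ c = α 0 * f (ρ 0) c
    W′ c = ∑[ s < K ] (α (suc s) * f (ρ (suc s)) c)
    i<ρ₀ : i < ρ 0
    i<ρ₀ = proj₁ (bounds 0 z<s)
    ρ₀<n : ρ 0 < n
    ρ₀<n = proj₂ (bounds 0 z<s)
    row-i : ∀ u c → setRow i u f i c ≈ u c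
    row-i u c = reflexive (≡.cong-app (setRow-≡ i u f) c)
    others : ∀ u v r c → r ≢ i → setRow i u f r c ≈ setRow i v f r c
    others u v r c r≢i = reflexive (≡.trans (≡.cong-app (setRow-≢ u f r≢i) c) (≡.sym (≡.cong-app (setRow-≢ v f r≢i) c)))

  det-add-row-combination : ∀ {n i K} (α : ℕ → Carrier) (ρ : ℕ → ℕ) {f g} → i < n →
                            (∀ s → s < K → i < ρ s × ρ s < n) → (∀ r c → r ≢ i → g r c ≈ f r c) →
                            (∀ c → g i c ≈ f i c + ∑[ s < K ] (α s * f (ρ s) c)) → det n g ≈ det n f
  det-add-row-combination {n} {i} {K} α ρ {f} {g} i<n bounds g≈f gᵢ = begin
    det n g                                ≈⟨ det-row-linear i<n (λ r c r≢i → sym (g≈f r c r≢i))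
                                                (λ r c r≢i → trans (reflexive (≡.cong-app (setRow-≢ W f r≢i) c))
                                                                   (sym (g≈f r c r≢i)))
                                                (λ c → trans (gᵢ c) (+-congˡ (sym (reflexive (≡.cong-app (setRow-≡ i W f) c))))) ⟩
    det n f + det n (setRow i W f)         ≈⟨ +-congˡ (det-row-combination K α ρ f i<n bounds) ⟩
    det n f + 0#                           ≈⟨ +-identityʳ _ ⟩
    det n f                                ∎
    where
    W : ℕ → Carrier
    W c = ∑[ s < K ] (α s * f (ρ s) c)

  mixRows : ℕ → Matrix → Matrix → Matrix
  mixRows zero    g f         = f
  mixRows (suc j) g f zero    = g zero
  mixRows (suc j) g f (suc r) = mixRows j (g ∘ suc) (f ∘ suc) r

  mixRows-< : ∀ {j r} g f → r < j → mixRows j g f r ≡ g r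
  mixRows-< {suc j} {zero}  g f _         = ≡.refl
  mixRows-< {suc j} {suc r} g f (s<s r<j) = mixRows-< (g ∘ suc) (f ∘ suc) r<j

  mixRows-≥ : ∀ {j r} g f → j ≤ r → mixRows j g f r ≡ f r
  mixRows-≥ {zero}          g f _         = ≡.refl
  mixRows-≥ {suc j} {suc r} g f (s≤s j≤r) = mixRows-≥ (g ∘ suc) (f ∘ suc) j≤r

  det-add-rows-below : ∀ {n m K} (α : ℕ → ℕ → Carrier) (ρ : ℕ → ℕ → ℕ) {f g} → m ≤ n →
                       (∀ i s → i < m → s < K → i < ρ i s × ρ i s < n) →
                       (∀ i c → i < m → g i c ≈ f i c + ∑[ s < K ] (α i s * f (ρ i s) c)) →
                       (∀ i c → m ≤ i → g i c ≈ f i c) → det n g ≈ det n f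
  det-add-rows-below {n} {m} {K} α ρ {f} {g} m≤n bounds upper lower = begin
    det n g                ≈⟨ det-cong n (λ r c _ _ → sym (mixRows-full r c)) ⟩
    det n (mixRows m g f)  ≈⟨ det-mixRows m ℕₚ.≤-refl ⟩
    det n f                ∎
    where
    mixRows-full : ∀ r c → mixRows m g f r c ≈ g r c
    mixRows-full r c with r <? m
    ... | yes r<m = reflexive (≡.cong-app (mixRows-< g f r<m) c)
    ... | no  r≮m = trans (reflexive (≡.cong-app (mixRows-≥ g f (ℕₚ.≮⇒≥ r≮m)) c)) (sym (lower r c (ℕₚ.≮⇒≥ r≮m)))
    det-mixRows : ∀ j → j ≤ m → det n (mixRows j g f) ≈ det n f
    det-mixRows zero    _     = refl
    det-mixRows (suc j) j<m = trans step (det-mixRows j (ℕₚ.<⇒≤ j<m))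
      where
      unchanged : ∀ r c → r ≢ j → mixRows (suc j) g f r c ≈ mixRows j g f r c
      unchanged r c r≢j with r <? j
      ... | yes r<j = reflexive (≡.trans (≡.cong-app (mixRows-< g f (ℕₚ.<-trans r<j (ℕₚ.n<1+n j))) c)
                                          (≡.sym (≡.cong-app (mixRows-< g f r<j) c)))
      ... | no  r≮j = reflexive (≡.trans (≡.cong-app (mixRows-≥ g f (ℕₚ.≤∧≢⇒< (ℕₚ.≮⇒≥ r≮j) (r≢j ∘ ≡.sym))) c)
                                          (≡.sym (≡.cong-app (mixRows-≥ g f (ℕₚ.≮⇒≥ r≮j)) c)))
      below : ∀ s c → s < K → mixRows j g f (ρ j s) c ≡ f (ρ j s) c
      below s c s<K = ≡.cong-app (mixRows-≥ g f (ℕₚ.<⇒≤ (proj₁ (bounds j s j<m s<K)))) c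
      step : det n (mixRows (suc j) g f) ≈ det n (mixRows j g f)
      step = det-add-row-combination (α j) (ρ j) (ℕₚ.<-≤-trans j<m m≤n) (λ s s<K → bounds j s j<m s<K) unchanged λ c → begin
        mixRows (suc j) g f j c                          ≡⟨ ≡.cong-app (mixRows-< g f (ℕₚ.n<1+n j)) c ⟩
        g j c                                            ≈⟨ upper j c j<m ⟩
        f j c + ∑[ s < K ] (α j s * f (ρ j s) c)         ≈⟨ +-cong (reflexive (≡.sym (≡.cong-app (mixRows-≥ g f ℕₚ.≤-refl) c)))
                                                                  (∑-cong λ s s<K → *-congˡ (reflexive (≡.sym (below s c s<K)))) ⟩
        mixRows j g f j c + ∑[ s < K ] (α j s * mixRows j g f (ρ j s) c) ∎

  det-zero-column : ∀ {n k} f → k < n → (∀ r → f r k ≈ 0#) → det n f ≈ 0#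
  det-zero-column {suc n} {k} f k<1+n zero-col = ∑-zero term
    where
    term : ∀ j → j < suc n → sign j * (f 0 j * det n (minor j f)) ≈ 0#
    term j j<1+n with j ≟ k
    ... | yes ≡.refl = trans (*-congˡ (trans (*-congʳ (zero-col 0)) (zeroˡ _))) (zeroʳ _)
    ... | no  j≢k    = trans (*-congˡ (*-congˡ (det-zero-column (minor j f)
                         (punchOutℕ-bounded j<1+n k<1+n (j≢k ∘ ≡.sym)) λ r →
                         trans (reflexive (≡.cong (f (suc r)) (punchInℕ-punchOutℕ (j≢k ∘ ≡.sym)))) (zero-col (suc r)))))
                             (x*[y*0]≈0 _ _)

  rowToTop : ℕ → Matrix → Matrix
  rowToTop r f zero    = f r
  rowToTop r f (suc k) = f (punchInℕ r k)

  det-rowToTop : ∀ {n r} f → r < n → det n f ≈ sign r * det n (rowToTop r f)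
  det-rowToTop {n} {zero}  f _      = sym (trans (*-identityˡ _) (det-cong n same))
    where
    same : ∀ i s → i < n → s < n → rowToTop 0 f i s ≈ f i s
    same zero    s _ _ = refl
    same (suc i) s _ _ = refl
  det-rowToTop {n} {suc r} f r+1<n = begin
    det n f                                    ≈⟨ sym (-‿involutive _) ⟩
    - - det n f                                ≈⟨ -‿cong (sym (det-swap-adjacent r f r+1<n)) ⟩
    - det n (f ∘ transposeSuc r)               ≈⟨ -‿cong (det-rowToTop _ (ℕₚ.<-trans (ℕₚ.n<1+n r) r+1<n)) ⟩
    - (sign r * det n (rowToTop r (f ∘ transposeSuc r)))
                                               ≈⟨ -‿distribˡ-* _ _ ⟩
    - sign r * det n (rowToTop r (f ∘ transposeSuc r))
                                               ≈⟨ *-congˡ (det-cong n same) ⟩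
    - sign r * det n (rowToTop (suc r) f)      ∎
    where
    same : ∀ i s → i < n → s < n → rowToTop r (f ∘ transposeSuc r) i s ≈ rowToTop (suc r) f i s
    same zero    s _ _ = reflexive (≡.cong (λ i → f i s) (transposeSuc-self r))
    same (suc k) s _ _ = reflexive (≡.cong (λ i → f i s) (transposeSuc-punchIn r k))

  det-unit-column : ∀ {n r k} f → r < suc n → k < suc n → (∀ r′ → f r′ k ≈ δ r′ r) →
                    det (suc n) f ≈ sign r * (sign k * det n (λ i j → f (punchInℕ r i) (punchInℕ k j)))
  det-unit-column {n} {r} {k} f r<1+n k<1+n unit = begin
    det (suc n) f                                                   ≈⟨ det-rowToTop f r<1+n ⟩
    sign r * det (suc n) (rowToTop r f)                             ≈⟨ *-congˡ (∑-single _ k<1+n others) ⟩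
    sign r * (sign k * (f r k * det n (minor k (rowToTop r f))))    ≈⟨ *-congˡ (*-congˡ (trans
                                                                         (*-congʳ (trans (unit r) (δ-refl r)))
                                                                         (*-identityˡ _))) ⟩
    sign r * (sign k * det n (λ i j → f (punchInℕ r i) (punchInℕ k j))) ∎
    where
    others : ∀ j → j < suc n → j ≢ k → sign j * (f r j * det n (minor j (rowToTop r f))) ≈ 0#
    others j j<1+n j≢k = trans (*-congˡ (*-congˡ (det-zero-column _
      (punchOutℕ-bounded j<1+n k<1+n (j≢k ∘ ≡.sym)) λ i →
      trans (reflexive (≡.cong (f (punchInℕ r i)) (punchInℕ-punchOutℕ (j≢k ∘ ≡.sym))))
            (trans (unit _) (δ-≢ (punchInℕᵢ≢i r i)))))) (x*[y*0]≈0 _ _)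

  det-unit-columns : ∀ {L n} m f → L ≤ n → (∀ r c → c < m → f r (n +ℕ c) ≈ δ r (L +ℕ c)) →
                     det (m +ℕ n) f ≈ sign (m *ℕ (L +ℕ n)) * det n (λ r k → f (skipBand L m r) k)
  det-unit-columns {L} {n} zero f _ _ =
    sym (trans (*-identityˡ _) (det-cong n λ r k _ _ → reflexive (≡.cong (λ i → f i k) (skipBand-empty L r))))
  det-unit-columns {L} {n} (suc m) f L≤n unit = begin
    det (suc (m +ℕ n)) f
      ≈⟨ det-unit-column f (s≤s (ℕₚ.≤-trans L≤n (ℕₚ.m≤n+m n m))) (s≤s (ℕₚ.m≤n+m n m)) column-n ⟩
    sign L * (sign n * det (m +ℕ n) f′)
      ≈⟨ *-congˡ (*-congˡ (det-unit-columns m f′ L≤n unit′)) ⟩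
    sign L * (sign n * (sign (m *ℕ (L +ℕ n)) * det n (λ r k → f′ (skipBand L m r) k)))
      ≈⟨ *-congˡ (*-congˡ (*-congˡ (det-cong n λ r k _ k<n →
           reflexive (≡.cong₂ f (punchInℕ-skipBand L m r) (punchInℕ-< k<n))))) ⟩
    sign L * (sign n * (sign (m *ℕ (L +ℕ n)) * D))
      ≈⟨ solve 4 (λ a b c d → a ⊗ (b ⊗ (c ⊗ d)) ⊜ ((a ⊗ b) ⊗ c) ⊗ d) refl _ _ _ _ ⟩
    ((sign L * sign n) * sign (m *ℕ (L +ℕ n))) * D
      ≈⟨ *-congʳ (trans (*-congʳ (sym (sign-+ L n))) (sym (sign-+ (L +ℕ n) _))) ⟩
    sign (suc m *ℕ (L +ℕ n)) * D ∎
    where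
    D : Carrier
    D = det n (λ r k → f (skipBand L (suc m) r) k)
    f′ : Matrix
    f′ i j = f (punchInℕ L i) (punchInℕ n j)
    column-n : ∀ r → f r n ≈ δ r L
    column-n r = begin
      f r n               ≡⟨ ≡.cong (f r) (ℕₚ.+-identityʳ n) ⟨
      f r (n +ℕ 0)        ≈⟨ unit r 0 z<s ⟩
      δ r (L +ℕ 0)        ≡⟨ ≡.cong (δ r) (ℕₚ.+-identityʳ L) ⟩
      δ r L               ∎
    unit′ : ∀ r c → c < m → f′ r (n +ℕ c) ≈ δ r (L +ℕ c)
    unit′ r c c<m = begin
      f (punchInℕ L r) (punchInℕ n (n +ℕ c))   ≡⟨ ≡.cong (f (punchInℕ L r)) (punchInℕ-+ n c) ⟩
      f (punchInℕ L r) (n +ℕ suc c)            ≈⟨ unit _ (suc c) (s<s c<m) ⟩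
      δ (punchInℕ L r) (L +ℕ suc c)            ≡⟨ ≡.cong (δ (punchInℕ L r)) (punchInℕ-+ L c) ⟨
      δ (punchInℕ L r) (punchInℕ L (L +ℕ c))   ≈⟨ δ-punchIn L r (L +ℕ c) ⟩
      δ r (L +ℕ c)                             ∎

  det-anti-block-triangular : ∀ m n f → (∀ r c → r < m → c < n → f r c ≈ 0#) →
    det (m +ℕ n) f ≈ sign (m *ℕ n) * (det m (λ r c → f r (n +ℕ c)) * det n (λ r c → f (m +ℕ r) c))
  det-anti-block-triangular zero    n f _          = sym (trans (*-identityˡ _) (*-identityˡ _))
  det-anti-block-triangular (suc m) n f zero-block = begin
    ∑ (suc m +ℕ n) G                      ≡⟨ ≡.cong (λ k → ∑ k G) (ℕₚ.+-comm (suc m) n) ⟩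
    ∑ (n +ℕ suc m) G                      ≈⟨ ∑-split n (suc m) G ⟩
    ∑ n G + ∑[ c < suc m ] G (n +ℕ c)     ≈⟨ +-congʳ (∑-zero λ j j<n →
                                               trans (*-congˡ (trans (*-congʳ (zero-block 0 j z<s j<n)) (zeroˡ _)))
                                                     (zeroʳ _)) ⟩
    0# + ∑[ c < suc m ] G (n +ℕ c)        ≈⟨ +-identityˡ _ ⟩
    ∑[ c < suc m ] G (n +ℕ c)             ≈⟨ ∑-cong term ⟩
    ∑[ c < suc m ] (sign (suc m *ℕ n) * (sign c * (A 0 c * det m (minor c A)) * DB))
                                          ≈⟨ sym (*-distribˡ-∑ _ _ _) ⟩
    sign (suc m *ℕ n) * ∑[ c < suc m ] (sign c * (A 0 c * det m (minor c A)) * DB)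
                                          ≈⟨ *-congˡ (sym (*-distribʳ-∑ DB _ _)) ⟩
    sign (suc m *ℕ n) * (det (suc m) A * DB) ∎
    where
    G : ℕ → Carrier
    G j = sign j * (f 0 j * det (m +ℕ n) (minor j f))
    A : Matrix
    A r c = f r (n +ℕ c)
    DB : Carrier
    DB = det n (λ r c → f (suc m +ℕ r) c)
    left : ∀ {c c′} → c′ < n → punchInℕ (n +ℕ c) c′ ≡ c′
    left {c} c′<n = punchInℕ-< (ℕₚ.<-≤-trans c′<n (ℕₚ.m≤m+n n c))
    term : ∀ c → c < suc m → G (n +ℕ c) ≈ sign (suc m *ℕ n) * (sign c * (A 0 c * det m (minor c A)) * DB)
    term c _ = begin
      sign (n +ℕ c) * (A 0 c * det (m +ℕ n) (minor (n +ℕ c) f))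
        ≈⟨ *-cong (sign-+ n c) (*-congˡ (det-anti-block-triangular m n (minor (n +ℕ c) f) λ r c′ r<m c′<n →
             trans (reflexive (≡.cong (f (suc r)) (left c′<n))) (zero-block (suc r) c′ (s<s r<m) c′<n))) ⟩
      (sign n * sign c) * (A 0 c * (sign (m *ℕ n) *
        (det m (λ r c′ → f (suc r) (punchInℕ (n +ℕ c) (n +ℕ c′))) *
         det n (λ r c′ → f (suc (m +ℕ r)) (punchInℕ (n +ℕ c) c′)))))
        ≈⟨ *-congˡ (*-congˡ (*-congˡ (*-cong
             (det-cong m λ r c′ _ _ → reflexive (≡.cong (f (suc r)) (punchInℕ-shift n c c′)))
             (det-cong n λ r c′ _ c′<n → reflexive (≡.cong (f (suc (m +ℕ r))) (left c′<n)))))) ⟩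
      (sign n * sign c) * (A 0 c * (sign (m *ℕ n) * (det m (minor c A) * DB)))
        ≈⟨ solve 6 (λ a b x y d e → (a ⊗ b) ⊗ (x ⊗ (y ⊗ (d ⊗ e))) ⊜ (a ⊗ y) ⊗ ((b ⊗ (x ⊗ d)) ⊗ e)) refl _ _ _ _ _ _ ⟩
      (sign n * sign (m *ℕ n)) * (sign c * (A 0 c * det m (minor c A)) * DB)
        ≈⟨ *-congʳ (sym (sign-+ n (m *ℕ n))) ⟩
      sign (suc m *ℕ n) * (sign c * (A 0 c * det m (minor c A)) * DB) ∎

  det-scale : ∀ n (u v : ℕ → Carrier) {f g} → (∀ r c → f r c ≈ u r * (v c * g r c)) →
              det n f ≈ (∏ n u * ∏ n v) * det n g
  det-scale zero    u v _ =
    sym (trans (*-congʳ (trans (reflexive (≡.cong₂ _*_ (∏-empty u) (∏-empty v))) (*-identityˡ 1#))) (*-identityˡ 1#))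
  det-scale (suc n) u v {f} {g} eq = trans (∑-cong term) (sym (*-distribˡ-∑ _ _ _))
    where
    term : ∀ j → j < suc n → sign j * (f 0 j * det n (minor j f)) ≈
                             (∏ (suc n) u * ∏ (suc n) v) * (sign j * (g 0 j * det n (minor j g)))
    term j j<1+n = begin
      sign j * (f 0 j * det n (minor j f))
        ≈⟨ *-congˡ (*-cong (eq 0 j) (det-scale n (u ∘ suc) (v ∘ punchInℕ j) λ r c → eq (suc r) _)) ⟩
      sign j * ((u 0 * (v j * g 0 j)) * ((∏ n (u ∘ suc) * ∏ n (v ∘ punchInℕ j)) * det n (minor j g)))
        ≈⟨ solve 7 (λ s u₀ vⱼ g₀ U V D → s ⊗ ((u₀ ⊗ (vⱼ ⊗ g₀)) ⊗ ((U ⊗ V) ⊗ D)) ⊜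
                                         (u₀ ⊗ U) ⊗ ((vⱼ ⊗ V) ⊗ (s ⊗ (g₀ ⊗ D)))) refl _ _ _ _ _ _ _ ⟩
      (u 0 * ∏ n (u ∘ suc)) * ((v j * ∏ n (v ∘ punchInℕ j)) * (sign j * (g 0 j * det n (minor j g))))
        ≈⟨ *-cong (reflexive (≡.sym (∏-suc n u))) (*-congʳ (sym (∏-remove v j<1+n))) ⟩
      ∏ (suc n) u * (∏ (suc n) v * (sign j * (g 0 j * det n (minor j g))))
        ≈⟨ sym (*-assoc _ _ _) ⟩
      (∏ (suc n) u * ∏ (suc n) v) * (sign j * (g 0 j * det n (minor j g))) ∎

module JacobiTrudi {c ℓ} (R : CommutativeRing c ℓ) where
  open CommutativeRing R hiding (zero)
  open RingOps rawRing using (sign; pow)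
  open Determinant R
  open import Algebra.Properties.CommutativeSemigroup *-commutativeSemigroup using (x∙yz≈y∙xz)
  open import Algebra.Solver.CommutativeMonoid *-commutativeMonoid using (solve; _⊜_) renaming (_⊕_ to _⊗_)
  open import Relation.Binary.Reasoning.Setoid setoid

  -- eᶜ n x s = e_{n-s}(x₀, …, x_{n-1}), the coefficient of y^s in ∏_{t<n} (x_t + y)
  eᶜ : ℕ → (ℕ → Carrier) → ℕ → Carrier
  eᶜ zero    x zero    = 1#
  eᶜ zero    x (suc s) = 0#
  eᶜ (suc n) x zero    = x 0 * eᶜ n (x ∘ suc) zero
  eᶜ (suc n) x (suc s) = x 0 * eᶜ n (x ∘ suc) (suc s) + eᶜ n (x ∘ suc) s

  eᶜ-cong : ∀ n {x y} s → (∀ t → x t ≈ y t) → eᶜ n x s ≈ eᶜ n y s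
  eᶜ-cong zero    zero    _  = refl
  eᶜ-cong zero    (suc s) _  = refl
  eᶜ-cong (suc n) zero    eq = *-cong (eq 0) (eᶜ-cong n zero (eq ∘ suc))
  eᶜ-cong (suc n) (suc s) eq = +-cong (*-cong (eq 0) (eᶜ-cong n (suc s) (eq ∘ suc))) (eᶜ-cong n s (eq ∘ suc))

  eᶜ-vanish : ∀ {n s} x → n < s → eᶜ n x s ≈ 0#
  eᶜ-vanish {zero}  {suc s} x _         = refl
  eᶜ-vanish {suc n} {suc s} x (s<s n<s) =
    trans (+-cong (trans (*-congˡ (eᶜ-vanish _ (ℕₚ.m<n⇒m<1+n n<s))) (zeroʳ _)) (eᶜ-vanish _ n<s)) (+-identityˡ 0#)

  eᶜ-top : ∀ n x → eᶜ n x n ≈ 1#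
  eᶜ-top zero    x = refl
  eᶜ-top (suc n) x =
    trans (+-cong (trans (*-congˡ (eᶜ-vanish _ (ℕₚ.n<1+n n))) (zeroʳ _)) (eᶜ-top n _)) (+-identityˡ 1#)

  vieta : ℕ → (ℕ → Carrier) → Carrier → Carrier
  vieta n x w = ∑[ s < suc n ] (eᶜ n x s * pow (- w) s)

  vieta-suc : ∀ n x w → vieta (suc n) x w ≈ (x 0 + - w) * vieta n (x ∘ suc) w
  vieta-suc n x w = begin
    ∑[ s < suc (suc n) ] (eᶜ (suc n) x s * pow (- w) s)
      ≡⟨ ∑-suc (suc n) _ ⟩
    x₀ * e′ 0 * 1# + ∑[ s < suc n ] ((x₀ * e′ (suc s) + e′ s) * (- w * pow (- w) s))
      ≈⟨ +-congˡ (trans (∑-cong λ s _ → split s) (∑-distrib-+ (suc n) _ _)) ⟩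
    x₀ * e′ 0 * 1# + (∑[ s < suc n ] (x₀ * (e′ (suc s) * pow (- w) (suc s))) +
                     ∑[ s < suc n ] (- w * (e′ s * pow (- w) s)))
      ≈⟨ +-congˡ (+-cong (sym (*-distribˡ-∑ x₀ _ _)) (sym (*-distribˡ-∑ (- w) _ _))) ⟩
    x₀ * e′ 0 * 1# + (x₀ * ∑[ s < suc n ] (e′ (suc s) * pow (- w) (suc s)) + - w * vieta n x′ w)
      ≈⟨ sym (+-assoc _ _ _) ⟩
    (x₀ * e′ 0 * 1# + x₀ * ∑[ s < suc n ] (e′ (suc s) * pow (- w) (suc s))) + - w * vieta n x′ w
      ≈⟨ +-congʳ (trans (+-congʳ (*-assoc _ _ _)) (sym (distribˡ x₀ _ _))) ⟩
    x₀ * (e′ 0 * 1# + ∑[ s < suc n ] (e′ (suc s) * pow (- w) (suc s))) + - w * vieta n x′ w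
      ≈⟨ +-congʳ (*-congˡ (trans (reflexive (≡.sym (∑-suc (suc n) _))) (∑-init-last (suc n) _))) ⟩
    x₀ * (vieta n x′ w + e′ (suc n) * pow (- w) (suc n)) + - w * vieta n x′ w
      ≈⟨ +-congʳ (*-congˡ (trans (+-congˡ (trans (*-congʳ (eᶜ-vanish x′ (ℕₚ.n<1+n n))) (zeroˡ _))) (+-identityʳ _))) ⟩
    x₀ * vieta n x′ w + - w * vieta n x′ w
      ≈⟨ sym (distribʳ _ _ _) ⟩
    (x₀ + - w) * vieta n x′ w ∎
    where
    x₀ : Carrier
    x₀ = x 0
    x′ e′ : ℕ → Carrier
    x′ = x ∘ suc
    e′ = eᶜ n x′
    split : ∀ s → (x₀ * e′ (suc s) + e′ s) * (- w * pow (- w) s) ≈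
                  x₀ * (e′ (suc s) * pow (- w) (suc s)) + - w * (e′ s * pow (- w) s)
    split s = trans (distribʳ _ _ _) (+-cong (*-assoc _ _ _) (x∙yz≈y∙xz _ _ _))

  vieta-root : ∀ {n j} x → j < n → vieta n x (x j) ≈ 0#
  vieta-root {suc n} {zero}  x _         =
    trans (vieta-suc n x (x 0)) (trans (*-congʳ (-‿inverseʳ (x 0))) (zeroˡ _))
  vieta-root {suc n} {suc j} x (s<s j<n) =
    trans (vieta-suc n x (x (suc j))) (trans (*-congˡ (vieta-root (x ∘ suc) j<n)) (zeroʳ _))

  -- For n = L + off this is the Jacobi–Trudi matrix (e_{L - i + k})_{i,k} of the dual identity.
  eMatrix : ℕ → ℕ → (ℕ → Carrier) → Matrix
  eMatrix n off x i k with k ≤? off +ℕ i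
  ... | yes _ = eᶜ n x (off +ℕ i ∸ k)
  ... | no  _ = 0#

  eMatrix-≤ : ∀ {n off x i k} → k ≤ off +ℕ i → eMatrix n off x i k ≈ eᶜ n x (off +ℕ i ∸ k)
  eMatrix-≤ {n} {off} {x} {i} {k} k≤ with k ≤? off +ℕ i
  ... | yes _ = refl
  ... | no  k≰ = ⊥-elim (k≰ k≤)

  eMatrix-≰ : ∀ {n off x i k} → ¬ k ≤ off +ℕ i → eMatrix n off x i k ≈ 0#
  eMatrix-≰ {n} {off} {x} {i} {k} k≰ with k ≤? off +ℕ i
  ... | yes k≤ = ⊥-elim (k≰ k≤)
  ... | no  _  = refl

  eMatrix-cong : ∀ n off {x y} i k → (∀ t → x t ≈ y t) → eMatrix n off x i k ≈ eMatrix n off y i k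
  eMatrix-cong n off i k eq with k ≤? off +ℕ i
  ... | yes _ = eᶜ-cong n (off +ℕ i ∸ k) eq
  ... | no  _ = refl

  alternantMatrix : ℕ → (ℕ → ℕ) → (ℕ → Carrier) → Matrix
  alternantMatrix n μ x r k = pow (x k) (μ r +ℕ (n ∸ 1 ∸ r))

  module DualJacobiTrudi (L off m : ℕ) (x : ℕ → Carrier) where
    n N K : ℕ
    n = L +ℕ off
    N = m +ℕ n
    K = n +ℕ off

    Y : Matrix
    Y i k with k <? n
    ... | yes _ = pow (x k) (N ∸ suc i)
    ... | no  _ = δ i (L +ℕ (k ∸ n))

    Y-vandermonde : ∀ i {k} → k < n → Y i k ≈ pow (x k) (N ∸ suc i)
    Y-vandermonde i {k} k<n with k <? n
    ... | yes _   = refl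
    ... | no  k≮n = ⊥-elim (k≮n k<n)

    Y-unit : ∀ i c → Y i (n +ℕ c) ≈ δ i (L +ℕ c)
    Y-unit i c with n +ℕ c <? n
    ... | yes n+c<n = ⊥-elim (ℕₚ.m+n≮m n c n+c<n)
    ... | no  _     = reflexive (≡.cong (λ k → δ i (L +ℕ k)) (ℕₚ.m+n∸m≡n n c))

    α : ℕ → Carrier
    α s = sign (n +ℕ s) * eᶜ n x s

    -- The term s = n is row i itself, as α n ≈ 1.
    Y′ : Matrix
    Y′ i k with i <? m
    ... | yes _ = ∑[ s < suc n ] (α s * Y (i +ℕ (n ∸ s)) k)
    ... | no  _ = Y i k

    Y′-top : ∀ {i} k → i < m → Y′ i k ≈ ∑[ s < suc n ] (α s * Y (i +ℕ (n ∸ s)) k)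
    Y′-top {i} k i<m with i <? m
    ... | yes _   = refl
    ... | no  i≮m = ⊥-elim (i≮m i<m)

    Y′-bottom : ∀ {i} k → ¬ i < m → Y′ i k ≈ Y i k
    Y′-bottom {i} k i≮m with i <? m
    ... | yes i<m = ⊥-elim (i≮m i<m)
    ... | no  _   = refl

    det-Y : det N Y ≈ sign (m *ℕ (L +ℕ n)) * det n (alternantMatrix n (rectℕ m L) x)
    det-Y = trans (det-unit-columns m Y (ℕₚ.m≤m+n L off) (λ r c _ → Y-unit r c)) (*-congˡ (det-cong n λ r k r<n k<n →
      trans (Y-vandermonde _ k<n) (reflexive (≡.cong (pow (x k)) (exponent-skipBand {L} m r r<n)))))

    det-Y′ : det N Y′ ≈ det N Y
    det-Y′ = det-add-rows-below (λ _ → α) (λ i s → i +ℕ (n ∸ s)) (ℕₚ.m≤m+n m n) bounds upper lower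
      where
      bounds : ∀ i s → i < m → s < n → i < i +ℕ (n ∸ s) × i +ℕ (n ∸ s) < N
      bounds i s i<m s<n = ℕₚ.m<m+n i (ℕₚ.m<n⇒0<n∸m s<n) , ℕₚ.+-mono-<-≤ i<m (ℕₚ.m∸n≤m n s)
      upper : ∀ i c → i < m → Y′ i c ≈ Y i c + ∑[ s < n ] (α s * Y (i +ℕ (n ∸ s)) c)
      upper i c i<m = begin
        Y′ i c                                                     ≈⟨ Y′-top c i<m ⟩
        ∑[ s < suc n ] (α s * Y (i +ℕ (n ∸ s)) c)                  ≈⟨ trans (∑-init-last n _) (+-comm _ _) ⟩
        α n * Y (i +ℕ (n ∸ n)) c + ∑[ s < n ] (α s * Y (i +ℕ (n ∸ s)) c)
          ≈⟨ +-congʳ (*-cong (trans (*-cong (sign-double n) (eᶜ-top n x)) (*-identityˡ 1#))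
                             (reflexive (≡.cong (λ r → Y r c) (≡.trans (≡.cong (i +ℕ_) (ℕₚ.n∸n≡0 n)) (ℕₚ.+-identityʳ i))))) ⟩
        1# * Y i c + ∑[ s < n ] (α s * Y (i +ℕ (n ∸ s)) c)         ≈⟨ +-congʳ (*-identityˡ _) ⟩
        Y i c + ∑[ s < n ] (α s * Y (i +ℕ (n ∸ s)) c)              ∎
      lower : ∀ i c → m ≤ i → Y′ i c ≈ Y i c
      lower i c m≤i = Y′-bottom c (ℕₚ.≤⇒≯ m≤i)

    top-left : ∀ {i k} → i < m → k < n → Y′ i k ≈ 0#
    top-left {i} {k} i<m k<n with ℕₚ.m≤n⇒∃[o]m+o≡n i<m
    ... | Q , m≡ = begin
      Y′ i k                                                           ≈⟨ Y′-top k i<m ⟩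
      ∑[ s < suc n ] (α s * Y (i +ℕ (n ∸ s)) k)                        ≈⟨ ∑-cong term ⟩
      ∑[ s < suc n ] ((sign n * pow (x k) Q) * (eᶜ n x s * pow (- x k) s)) ≈⟨ sym (*-distribˡ-∑ _ _ _) ⟩
      (sign n * pow (x k) Q) * vieta n x (x k)                         ≈⟨ *-congˡ (vieta-root x k<n) ⟩
      (sign n * pow (x k) Q) * 0#                                      ≈⟨ zeroʳ _ ⟩
      0#                                                               ∎
      where
      term : ∀ s → s < suc n → α s * Y (i +ℕ (n ∸ s)) k ≈ (sign n * pow (x k) Q) * (eᶜ n x s * pow (- x k) s)
      term s (s≤s s≤n) = begin
        α s * Y (i +ℕ (n ∸ s)) k
          ≈⟨ *-congˡ (Y-vandermonde _ k<n) ⟩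
        (sign (n +ℕ s) * eᶜ n x s) * pow (x k) (N ∸ suc (i +ℕ (n ∸ s)))
          ≡⟨ ≡.cong (λ e → (sign (n +ℕ s) * eᶜ n x s) * pow (x k) e)
                    (≡.trans (≡.cong (λ m → (m +ℕ n) ∸ suc (i +ℕ (n ∸ s))) (≡.sym m≡)) (exponent-shift i Q n s s≤n)) ⟩
        (sign (n +ℕ s) * eᶜ n x s) * pow (x k) (Q +ℕ s)
          ≈⟨ *-cong (*-congʳ (sign-+ n s)) (pow-+ (x k) Q s) ⟩
        ((sign n * sign s) * eᶜ n x s) * (pow (x k) Q * pow (x k) s)
          ≈⟨ solve 5 (λ a b e p q → ((a ⊗ b) ⊗ e) ⊗ (p ⊗ q) ⊜ (a ⊗ p) ⊗ (e ⊗ (b ⊗ q))) refl _ _ _ _ _ ⟩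
        (sign n * pow (x k) Q) * (eᶜ n x s * (sign s * pow (x k) s))
          ≈⟨ *-congˡ (*-congˡ (sym (pow-neg (x k) s))) ⟩
        (sign n * pow (x k) Q) * (eᶜ n x s * pow (- x k) s) ∎

    top-right : ∀ {i} c → i < m → Y′ i (n +ℕ c) ≈ sign (K +ℕ i) * (sign c * eMatrix n off x i c)
    top-right {i} c i<m = trans (Y′-top _ i<m) (trans (∑-cong λ s _ → *-congˡ (Y-unit _ c)) entry)
      where
      miss : ∀ s → s < suc n → s +ℕ c ≢ off +ℕ i → α s * δ (i +ℕ (n ∸ s)) (L +ℕ c) ≈ 0#
      miss s (s≤s s≤n) unsolved = trans (*-congˡ (δ-≢ (unsolved ∘ unit-row-solve {L} {off} {i} s≤n))) (zeroʳ _)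
      solution-unique : ∀ {s} → c ≤ off +ℕ i → s +ℕ c ≡ off +ℕ i → s ≡ off +ℕ i ∸ c
      solution-unique {s} c≤ solved = ℕₚ.+-cancelʳ-≡ c s _ (≡.trans solved (≡.sym (ℕₚ.m∸n+n≡m c≤)))
      entry : ∑[ s < suc n ] (α s * δ (i +ℕ (n ∸ s)) (L +ℕ c)) ≈ sign (K +ℕ i) * (sign c * eMatrix n off x i c)
      entry with c ≤? off +ℕ i
      ... | no c≰ = begin
        ∑[ s < suc n ] (α s * δ (i +ℕ (n ∸ s)) (L +ℕ c))
          ≈⟨ ∑-zero (λ s s<1+n → miss s s<1+n λ solved → c≰ (ℕₚ.≤-trans (ℕₚ.m≤n+m c s) (ℕₚ.≤-reflexive solved))) ⟩
        0#                                              ≈⟨ sym (x*[y*0]≈0 _ _) ⟩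
        sign (K +ℕ i) * (sign c * 0#)                   ∎
      ... | yes c≤ with off +ℕ i ∸ c ≤? n
      ...   | no t≰n = begin
        ∑[ s < suc n ] (α s * δ (i +ℕ (n ∸ s)) (L +ℕ c))
          ≈⟨ ∑-zero (λ s s<1+n → miss s s<1+n λ solved →
               t≰n (≡.subst (_≤ n) (solution-unique c≤ solved) (s≤s⁻¹ s<1+n))) ⟩
        0#                                              ≈⟨ sym (x*[y*0]≈0 _ _) ⟩
        sign (K +ℕ i) * (sign c * 0#)                   ≈⟨ *-congˡ (*-congˡ (sym (eᶜ-vanish x (ℕₚ.≰⇒> t≰n)))) ⟩
        sign (K +ℕ i) * (sign c * eᶜ n x (off +ℕ i ∸ c)) ∎
      ...   | yes t≤n = begin
        ∑[ s < suc n ] (α s * δ (i +ℕ (n ∸ s)) (L +ℕ c))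
          ≈⟨ ∑-single _ (s≤s t≤n) (λ s s<1+n s≢t → miss s s<1+n (s≢t ∘ solution-unique c≤)) ⟩
        α t * δ (i +ℕ (n ∸ t)) (L +ℕ c)
          ≈⟨ *-congˡ (trans (reflexive (≡.cong (λ r → δ r (L +ℕ c)) (unit-row-hit {L} {off} {i} t≤n (ℕₚ.m∸n+n≡m c≤)))) (δ-refl (L +ℕ c))) ⟩
        α t * 1#                                        ≈⟨ *-identityʳ _ ⟩
        sign (n +ℕ t) * eᶜ n x t                        ≈⟨ *-congʳ sign-split ⟩
        (sign (K +ℕ i) * sign c) * eᶜ n x t             ≈⟨ *-assoc _ _ _ ⟩
        sign (K +ℕ i) * (sign c * eᶜ n x t)             ∎
        where
        t : ℕ
        t = off +ℕ i ∸ c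
        sign-split : sign (n +ℕ t) ≈ sign (K +ℕ i) * sign c
        sign-split = begin
          sign (n +ℕ t)                     ≈⟨ sym (trans (*-congˡ (sign-square c)) (*-identityʳ _)) ⟩
          sign (n +ℕ t) * (sign c * sign c) ≈⟨ sym (*-assoc _ _ _) ⟩
          (sign (n +ℕ t) * sign c) * sign c ≈⟨ *-congʳ (sym (sign-+ (n +ℕ t) c)) ⟩
          sign (n +ℕ t +ℕ c) * sign c       ≡⟨ ≡.cong (λ e → sign e * sign c) (≡.trans (ℕₚ.+-assoc n t c)
                                                 (≡.trans (≡.cong (n +ℕ_) (ℕₚ.m∸n+n≡m c≤)) (≡.sym (ℕₚ.+-assoc n off i)))) ⟩
          sign (K +ℕ i) * sign c            ∎

    bottom-left : ∀ r {k} → k < n → Y′ (m +ℕ r) k ≈ pow (x k) (n ∸ 1 ∸ r)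
    bottom-left r k<n = trans (Y′-bottom _ (ℕₚ.m+n≮m m r))
      (trans (Y-vandermonde _ k<n) (reflexive (≡.cong (pow (x _)) (exponent-below m n r))))

    ∏-signs : ∏[ i < m ] sign (K +ℕ i) * ∏[ c < m ] sign c ≈ pow (sign K) m
    ∏-signs = begin
      ∏[ i < m ] sign (K +ℕ i) * ∏ m sign              ≈⟨ *-congʳ (trans (∏-cong λ i _ → sign-+ K i) (∏-distrib-* m _ _)) ⟩
      (∏[ i < m ] sign K * ∏ m sign) * ∏ m sign        ≈⟨ *-assoc _ _ _ ⟩
      ∏[ i < m ] sign K * (∏ m sign * ∏ m sign)        ≈⟨ *-cong (∏-const m (sign K))
                                                             (trans (sym (∏-distrib-* m sign sign)) (∏-ones λ i _ → sign-square i)) ⟩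
      pow (sign K) m * 1#                              ≈⟨ *-identityʳ _ ⟩
      pow (sign K) m                                   ∎

    det-Y′-blocks : det N Y′ ≈ sign (m *ℕ n) * ((pow (sign K) m * det m (eMatrix n off x)) *
                                                 det n (alternantMatrix n (λ _ → 0) x))
    det-Y′-blocks = trans (det-anti-block-triangular m n Y′ λ r c r<m c<n → top-left r<m c<n) (*-congˡ (*-cong
      (trans (det-cong m λ r c r<m _ → top-right c r<m)
             (trans (det-scale m (λ i → sign (K +ℕ i)) sign λ _ _ → refl) (*-congʳ ∏-signs)))
      (det-cong n λ r k _ k<n → bottom-left r k<n)))

    total-sign : sign (m *ℕ (L +ℕ n)) * (sign (m *ℕ n) * pow (sign K) m) ≈ 1#
    total-sign = begin
      sign (m *ℕ (L +ℕ n)) * (sign (m *ℕ n) * pow (sign K) m)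
        ≈⟨ *-congˡ (*-congˡ (pow-sign K m)) ⟩
      sign (m *ℕ (L +ℕ n)) * (sign (m *ℕ n) * sign (m *ℕ K))
        ≈⟨ sym (trans (sign-+ (m *ℕ (L +ℕ n)) _) (*-congˡ (sign-+ (m *ℕ n) (m *ℕ K)))) ⟩
      sign (m *ℕ (L +ℕ n) +ℕ (m *ℕ n +ℕ m *ℕ K))
        ≡⟨ ≡.cong sign (four-n m L off) ⟩
      sign ((m *ℕ n +ℕ m *ℕ n) +ℕ (m *ℕ n +ℕ m *ℕ n))
        ≈⟨ sign-double (m *ℕ n +ℕ m *ℕ n) ⟩
      1# ∎
      where
      four-n : ∀ m L off → m *ℕ (L +ℕ (L +ℕ off)) +ℕ (m *ℕ (L +ℕ off) +ℕ m *ℕ ((L +ℕ off) +ℕ off)) ≡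
                           (m *ℕ (L +ℕ off) +ℕ m *ℕ (L +ℕ off)) +ℕ (m *ℕ (L +ℕ off) +ℕ m *ℕ (L +ℕ off))
      four-n = solve-∀

    dual-Jacobi-Trudi : det m (eMatrix n off x) * det n (alternantMatrix n (λ _ → 0) x) ≈
                        det n (alternantMatrix n (rectℕ m L) x)
    dual-Jacobi-Trudi = begin
      dE * dV                               ≈⟨ sym (*-identityˡ _) ⟩
      1# * (dE * dV)                        ≈⟨ *-congʳ (sym total-sign) ⟩
      (S₁ * (S₂ * P)) * (dE * dV)           ≈⟨ solve 5 (λ a b p e v → (a ⊗ (b ⊗ p)) ⊗ (e ⊗ v) ⊜ a ⊗ (b ⊗ ((p ⊗ e) ⊗ v)))
                                                     refl _ _ _ _ _ ⟩
      S₁ * (S₂ * ((P * dE) * dV))           ≈⟨ *-congˡ (sym det-Y′-blocks) ⟩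
      S₁ * det N Y′                         ≈⟨ *-congˡ (trans det-Y′ det-Y) ⟩
      S₁ * (S₁ * dA)                        ≈⟨ sym (*-assoc _ _ _) ⟩
      (S₁ * S₁) * dA                        ≈⟨ *-congʳ (sign-square (m *ℕ (L +ℕ n))) ⟩
      1# * dA                               ≈⟨ *-identityˡ _ ⟩
      dA                                    ∎
      where
      S₁ S₂ P dE dV dA : Carrier
      S₁ = sign (m *ℕ (L +ℕ n))
      S₂ = sign (m *ℕ n)
      P  = pow (sign K) m
      dE = det m (eMatrix n off x)
      dV = det n (alternantMatrix n (λ _ → 0) x)
      dA = det n (alternantMatrix n (rectℕ m L) x)

  open DualJacobiTrudi public using (dual-Jacobi-Trudi)

module Polynomials {c ℓ} (𝕂 : Field c ℓ) (n : ℕ) where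
  open FieldDefs 𝕂
  open CommutativeRing (Field.commutativeRing 𝕂)
    using (refl; sym; trans; reflexive; setoid; +-cong; +-congˡ; +-congʳ; *-cong; *-congˡ; *-congʳ; +-assoc; +-comm;
           +-identityˡ; +-identityʳ; *-assoc; *-comm; *-identityˡ; *-identityʳ; distribˡ; zeroʳ; -‿cong;
           -‿inverseˡ; -‿inverseʳ; +-commutativeSemigroup; *-commutativeSemigroup; ring)
  open import Algebra.Properties.Ring ring using (-‿+-comm; -0#≈0#)
  open import Algebra.Properties.CommutativeSemigroup +-commutativeSemigroup
    using () renaming (interchange to +-interchange)
  open import Algebra.Properties.CommutativeSemigroup *-commutativeSemigroup using (interchange)
  open import Relation.Binary.Reasoning.Setoid setoid

  Term : Set c
  Term = Carrier × Vec ℕ n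

  infixl 6 _⊕_
  _⊕_ : Vec ℕ n → Vec ℕ n → Vec ℕ n
  _⊕_ = zipWith _+ℕ_

  _⊙_ : Term → Term → Term
  t ⊙ u = (proj₁ t * proj₁ u , proj₂ t ⊕ proj₂ u)

  infixl 7 _·_
  _·_ : Poly n → Poly n → Poly n
  P · Q = concatMap (λ t → map (t ⊙_) Q) P

  neg : Poly n → Poly n
  neg = map (map₁ -_)

  one : Poly n
  one = (1# , replicate n 0) ∷ []

  ⊕-cancelˡ : ∀ {k} (v u e : Vec ℕ k) → zipWith _+ℕ_ v u ≡ e → zipWith _∸_ e v ≡ u
  ⊕-cancelˡ Vec.[] Vec.[] Vec.[] _ = ≡.refl
  ⊕-cancelˡ (x Vec.∷ v) (y Vec.∷ u) (z Vec.∷ e) eq with Vecₚ.∷-injective eq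
  ... | x+y≡z , v⊕u≡e = ≡.cong₂ Vec._∷_ (≡.trans (≡.cong (_∸ x) (≡.sym x+y≡z)) (ℕₚ.m+n∸m≡n x y)) (⊕-cancelˡ v u e v⊕u≡e)

  δᵥ : Vec ℕ n → Vec ℕ n → Carrier
  δᵥ m e with Vecₚ.≡-dec _≟_ m e
  ... | yes _ = 1#
  ... | no  _ = 0#

  δᵥ-iff : ∀ {m e m′ e′} → (m ≡ e → m′ ≡ e′) → (m′ ≡ e′ → m ≡ e) → δᵥ m e ≈ δᵥ m′ e′
  δᵥ-iff {m} {e} {m′} {e′} to from with Vecₚ.≡-dec _≟_ m e | Vecₚ.≡-dec _≟_ m′ e′
  ... | yes _   | yes _     = refl
  ... | no  _   | no  _     = refl
  ... | yes m≡e | no  m′≢e′ = ⊥-elim (m′≢e′ (to m≡e))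
  ... | no  m≢e | yes m′≡e′ = ⊥-elim (m≢e (from m′≡e′))

  δᵥ-≢ : ∀ {m e} → m ≢ e → δᵥ m e ≈ 0#
  δᵥ-≢ {m} {e} m≢e with Vecₚ.≡-dec _≟_ m e
  ... | yes m≡e = ⊥-elim (m≢e m≡e)
  ... | no  _   = refl

  opaque
    ∑ₗ : List Term → (Term → Carrier) → Carrier
    ∑ₗ []      g = 0#
    ∑ₗ (t ∷ P) g = g t + ∑ₗ P g

  opaque
    unfolding ∑ₗ

    ∑ₗ-[] : ∀ g → ∑ₗ [] g ≈ 0#
    ∑ₗ-[] g = refl

    ∑ₗ-∷ : ∀ t P g → ∑ₗ (t ∷ P) g ≈ g t + ∑ₗ P g
    ∑ₗ-∷ t P g = refl

    ∑ₗ-cong : ∀ P {g h} → (∀ t → g t ≈ h t) → ∑ₗ P g ≈ ∑ₗ P h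
    ∑ₗ-cong []      eq = refl
    ∑ₗ-cong (t ∷ P) eq = +-cong (eq t) (∑ₗ-cong P eq)

    ∑ₗ-zero : ∀ P {g} → (∀ t → g t ≈ 0#) → ∑ₗ P g ≈ 0#
    ∑ₗ-zero []      eq = refl
    ∑ₗ-zero (t ∷ P) eq = trans (+-cong (eq t) (∑ₗ-zero P eq)) (+-identityˡ 0#)

    ∑ₗ-++ : ∀ P Q g → ∑ₗ (P ++ Q) g ≈ ∑ₗ P g + ∑ₗ Q g
    ∑ₗ-++ []      Q g = sym (+-identityˡ _)
    ∑ₗ-++ (t ∷ P) Q g = trans (+-congˡ (∑ₗ-++ P Q g)) (sym (+-assoc _ _ _))

    ∑ₗ-map : ∀ f P g → ∑ₗ (map f P) g ≈ ∑ₗ P (g ∘ f)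
    ∑ₗ-map f []      g = refl
    ∑ₗ-map f (t ∷ P) g = +-congˡ (∑ₗ-map f P g)

    ∑ₗ-concatMap : ∀ f P g → ∑ₗ (concatMap f P) g ≈ ∑ₗ P (λ t → ∑ₗ (f t) g)
    ∑ₗ-concatMap f []      g = refl
    ∑ₗ-concatMap f (t ∷ P) g = trans (∑ₗ-++ (f t) (concatMap f P) g) (+-congˡ (∑ₗ-concatMap f P g))

    ∑ₗ-distrib-+ : ∀ P g h → ∑ₗ P (λ t → g t + h t) ≈ ∑ₗ P g + ∑ₗ P h
    ∑ₗ-distrib-+ []      g h = sym (+-identityˡ 0#)
    ∑ₗ-distrib-+ (t ∷ P) g h = trans (+-congˡ (∑ₗ-distrib-+ P g h)) (+-interchange _ _ _ _)

    *-distribˡ-∑ₗ : ∀ x P g → x * ∑ₗ P g ≈ ∑ₗ P (λ t → x * g t)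
    *-distribˡ-∑ₗ x []      g = zeroʳ x
    *-distribˡ-∑ₗ x (t ∷ P) g = trans (distribˡ x _ _) (+-congˡ (*-distribˡ-∑ₗ x P g))

    ∑ₗ-comm : ∀ P Q (g : Term → Term → Carrier) → ∑ₗ P (λ t → ∑ₗ Q (g t)) ≈ ∑ₗ Q (λ u → ∑ₗ P (λ t → g t u))
    ∑ₗ-comm []      Q g = sym (∑ₗ-zero Q λ _ → refl)
    ∑ₗ-comm (t ∷ P) Q g = trans (+-congˡ (∑ₗ-comm P Q g)) (sym (∑ₗ-distrib-+ Q (g t) _))

    coeff≈∑ₗ : ∀ P e → coeff P e ≈ ∑ₗ P (λ t → proj₁ t * δᵥ (proj₂ t) e)
    coeff≈∑ₗ []            e = refl
    coeff≈∑ₗ ((a , m) ∷ P) e with Vecₚ.≡-dec _≟_ m e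
    ... | yes _ = +-cong (sym (*-identityʳ a)) (coeff≈∑ₗ P e)
    ... | no  _ = trans (coeff≈∑ₗ P e) (sym (trans (+-congʳ (zeroʳ a)) (+-identityˡ _)))

  coeff-++ : ∀ P Q e → coeff (P ++ Q) e ≈ coeff P e + coeff Q e
  coeff-++ P Q e = trans (coeff≈∑ₗ (P ++ Q) e) (trans (∑ₗ-++ P Q _) (sym (+-cong (coeff≈∑ₗ P e) (coeff≈∑ₗ Q e))))

  coeff-neg : ∀ P e → coeff (neg P) e ≈ - coeff P e
  coeff-neg []            e = sym -0#≈0#
  coeff-neg ((a , m) ∷ P) e with Vecₚ.≡-dec _≟_ m e
  ... | yes _ = trans (+-congˡ (coeff-neg P e)) (-‿+-comm a _)
  ... | no  _ = coeff-neg P e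

  coeff-· : ∀ P Q e → coeff (P · Q) e ≈ ∑ₗ P (λ t → ∑ₗ Q (λ u → proj₁ (t ⊙ u) * δᵥ (proj₂ (t ⊙ u)) e))
  coeff-· P Q e = begin
    coeff (P · Q) e                                                       ≈⟨ coeff≈∑ₗ (P · Q) e ⟩
    ∑ₗ (concatMap (λ t → map (t ⊙_) Q) P) (λ s → proj₁ s * δᵥ (proj₂ s) e) ≈⟨ ∑ₗ-concatMap _ P _ ⟩
    ∑ₗ P (λ t → ∑ₗ (map (t ⊙_) Q) (λ s → proj₁ s * δᵥ (proj₂ s) e))       ≈⟨ ∑ₗ-cong P (λ t → ∑ₗ-map (t ⊙_) Q _) ⟩
    ∑ₗ P (λ t → ∑ₗ Q (λ u → proj₁ (t ⊙ u) * δᵥ (proj₂ (t ⊙ u)) e))       ∎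

  -- shifted Q v e is the coefficient of z^e in z^v · Q.
  shifted : Poly n → Vec ℕ n → Vec ℕ n → Carrier
  shifted Q v e = ∑ₗ Q (λ u → proj₁ u * δᵥ (v ⊕ proj₂ u) e)

  coeff-·-shifted : ∀ P Q e → coeff (P · Q) e ≈ ∑ₗ P (λ t → proj₁ t * shifted Q (proj₂ t) e)
  coeff-·-shifted P Q e = trans (coeff-· P Q e) (∑ₗ-cong P λ t →
    trans (∑ₗ-cong Q (λ u → *-assoc _ _ _)) (sym (*-distribˡ-∑ₗ (proj₁ t) Q _)))

  shifted-cong : ∀ {Q Q′} v e → Q ≈ₚ Q′ → shifted Q v e ≈ shifted Q′ v e
  shifted-cong {Q} {Q′} v e Q≈Q′ with Vecₚ.≡-dec _≟_ (v ⊕ zipWith _∸_ e v) e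
  ... | yes fits = trans (as-coeff Q) (trans (Q≈Q′ _) (sym (as-coeff Q′)))
    where
    as-coeff : ∀ Q → shifted Q v e ≈ coeff Q (zipWith _∸_ e v)
    as-coeff Q = trans (∑ₗ-cong Q λ u → *-congˡ (δᵥ-iff (λ hit → ≡.sym (⊕-cancelˡ v (proj₂ u) e hit))
                                                      (λ m≡ → ≡.subst (λ w → v ⊕ w ≡ e) (≡.sym m≡) fits)))
                       (sym (coeff≈∑ₗ Q _))
  ... | no  misfit = trans (vanishes Q) (sym (vanishes Q′))
    where
    vanishes : ∀ Q → shifted Q v e ≈ 0#
    vanishes Q = ∑ₗ-zero Q λ u → trans (*-congˡ (δᵥ-≢ λ hit →
      misfit (≡.subst (λ w → v ⊕ w ≡ e) (≡.sym (⊕-cancelˡ v (proj₂ u) e hit)) hit))) (zeroʳ _)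

  ⊕-comm : ∀ m m′ → m ⊕ m′ ≡ m′ ⊕ m
  ⊕-comm = Vecₚ.zipWith-comm ℕₚ.+-comm

  ⊕-assoc : ∀ m m′ m″ → m ⊕ m′ ⊕ m″ ≡ m ⊕ (m′ ⊕ m″)
  ⊕-assoc = Vecₚ.zipWith-assoc ℕₚ.+-assoc

  ·-congʳ : ∀ P {Q Q′} → Q ≈ₚ Q′ → (P · Q) ≈ₚ (P · Q′)
  ·-congʳ P Q≈Q′ e = trans (coeff-·-shifted P _ e)
    (trans (∑ₗ-cong P λ t → *-congˡ (shifted-cong (proj₂ t) e Q≈Q′)) (sym (coeff-·-shifted P _ e)))

  ·-comm : ∀ P Q → (P · Q) ≈ₚ (Q · P)
  ·-comm P Q e = begin
    coeff (P · Q) e                                                   ≈⟨ coeff-· P Q e ⟩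
    ∑ₗ P (λ t → ∑ₗ Q (λ u → proj₁ (t ⊙ u) * δᵥ (proj₂ (t ⊙ u)) e))    ≈⟨ ∑ₗ-comm P Q _ ⟩
    ∑ₗ Q (λ u → ∑ₗ P (λ t → proj₁ (t ⊙ u) * δᵥ (proj₂ (t ⊙ u)) e))    ≈⟨ ∑ₗ-cong Q (λ u → ∑ₗ-cong P λ t →
                                                                          *-cong (*-comm _ _) (reflexive (≡.cong (λ m → δᵥ m e)
                                                                            (⊕-comm (proj₂ t) (proj₂ u))))) ⟩
    ∑ₗ Q (λ u → ∑ₗ P (λ t → proj₁ (u ⊙ t) * δᵥ (proj₂ (u ⊙ t)) e))    ≈⟨ sym (coeff-· Q P e) ⟩
    coeff (Q · P) e                                                   ∎

  ·-cong : ∀ {P P′ Q Q′} → P ≈ₚ P′ → Q ≈ₚ Q′ → (P · Q) ≈ₚ (P′ · Q′)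
  ·-cong {P} {P′} {Q} {Q′} P≈P′ Q≈Q′ e =
    trans (·-congʳ P Q≈Q′ e) (trans (·-comm P Q′ e) (trans (·-congʳ Q′ P≈P′ e) (·-comm Q′ P′ e)))

  ·-assoc : ∀ P Q S → ((P · Q) · S) ≈ₚ (P · (Q · S))
  ·-assoc P Q S e = begin
    coeff ((P · Q) · S) e
      ≈⟨ coeff-· (P · Q) S e ⟩
    ∑ₗ (P · Q) (λ t → ∑ₗ S (λ w → proj₁ (t ⊙ w) * δᵥ (proj₂ (t ⊙ w)) e))
      ≈⟨ trans (∑ₗ-concatMap _ P _) (∑ₗ-cong P λ t → ∑ₗ-map (t ⊙_) Q _) ⟩
    ∑ₗ P (λ t → ∑ₗ Q (λ u → ∑ₗ S (λ w → proj₁ ((t ⊙ u) ⊙ w) * δᵥ (proj₂ ((t ⊙ u) ⊙ w)) e)))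
      ≈⟨ ∑ₗ-cong P (λ t → ∑ₗ-cong Q λ u → ∑ₗ-cong S λ w → *-cong (*-assoc _ _ _)
           (reflexive (≡.cong (λ m → δᵥ m e) (⊕-assoc (proj₂ t) (proj₂ u) (proj₂ w))))) ⟩
    ∑ₗ P (λ t → ∑ₗ Q (λ u → ∑ₗ S (λ w → proj₁ (t ⊙ (u ⊙ w)) * δᵥ (proj₂ (t ⊙ (u ⊙ w))) e)))
      ≈⟨ sym (∑ₗ-cong P λ t → trans (∑ₗ-concatMap _ Q _) (∑ₗ-cong Q λ u → ∑ₗ-map (u ⊙_) S _)) ⟩
    ∑ₗ P (λ t → ∑ₗ (Q · S) (λ s → proj₁ (t ⊙ s) * δᵥ (proj₂ (t ⊙ s)) e))
      ≈⟨ sym (coeff-· P (Q · S) e) ⟩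
    coeff (P · (Q · S)) e ∎

  ·-distribˡ-++ : ∀ P Q S → (P · (Q ++ S)) ≈ₚ (P · Q ++ P · S)
  ·-distribˡ-++ P Q S e = begin
    coeff (P · (Q ++ S)) e                    ≈⟨ coeff-· P (Q ++ S) e ⟩
    ∑ₗ P (λ t → ∑ₗ (Q ++ S) (term t))         ≈⟨ trans (∑ₗ-cong P λ t → ∑ₗ-++ Q S (term t)) (∑ₗ-distrib-+ P _ _) ⟩
    ∑ₗ P (λ t → ∑ₗ Q (term t)) + ∑ₗ P (λ t → ∑ₗ S (term t))
                                              ≈⟨ sym (+-cong (coeff-· P Q e) (coeff-· P S e)) ⟩
    coeff (P · Q) e + coeff (P · S) e         ≈⟨ sym (coeff-++ (P · Q) (P · S) e) ⟩
    coeff (P · Q ++ P · S) e                  ∎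
    where
    term : Term → Term → Carrier
    term t u = proj₁ (t ⊙ u) * δᵥ (proj₂ (t ⊙ u)) e

  ·-identityˡ : ∀ P → (one · P) ≈ₚ P
  ·-identityˡ P e = begin
    coeff (one · P) e                                  ≈⟨ coeff-· one P e ⟩
    ∑ₗ (one) (λ t → ∑ₗ P (λ u → proj₁ (t ⊙ u) * δᵥ (proj₂ (t ⊙ u)) e))
                                                       ≈⟨ trans (∑ₗ-∷ _ [] _) (trans (+-congˡ (∑ₗ-[] _)) (+-identityʳ _)) ⟩
    ∑ₗ P (λ u → (1# * proj₁ u) * δᵥ (replicate n 0 ⊕ proj₂ u) e)
                                                       ≈⟨ ∑ₗ-cong P (λ u → *-cong (*-identityˡ _)
                                                            (reflexive (≡.cong (λ m → δᵥ m e)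
                                                              (Vecₚ.zipWith-identityˡ ℕₚ.+-identityˡ (proj₂ u))))) ⟩
    ∑ₗ P (λ u → proj₁ u * δᵥ (proj₂ u) e)              ≈⟨ sym (coeff≈∑ₗ P e) ⟩
    coeff P e                                          ∎

  ≈ₚ-setoid : Setoid c ℓ
  ≈ₚ-setoid = record
    { Carrier       = Poly n
    ; _≈_           = _≈ₚ_
    ; isEquivalence = record
      { refl  = λ _ → refl
      ; sym   = λ P≈Q e → sym (P≈Q e)
      ; trans = λ P≈Q Q≈S e → trans (P≈Q e) (Q≈S e)
      }
    }

  open import Algebra.Consequences.Setoid ≈ₚ-setoid using (comm∧idˡ⇒id; comm∧distrˡ⇒distr)

  ++-cong : ∀ {P P′ Q Q′} → P ≈ₚ P′ → Q ≈ₚ Q′ → (P ++ Q) ≈ₚ (P′ ++ Q′)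
  ++-cong {P} {P′} {Q} {Q′} P≈P′ Q≈Q′ e =
    trans (coeff-++ P Q e) (trans (+-cong (P≈P′ e) (Q≈Q′ e)) (sym (coeff-++ P′ Q′ e)))

  polynomialRing : CommutativeRing c ℓ
  polynomialRing = record
    { Carrier = Poly n ; _≈_ = _≈ₚ_ ; _+_ = _++_ ; _*_ = _·_ ; -_ = neg ; 0# = [] ; 1# = one
    ; isCommutativeRing = record
      { isRing = record
        { +-isAbelianGroup = record
          { isGroup = record
            { isMonoid = record
              { isSemigroup = record
                { isMagma = record
                  { isEquivalence = Setoid.isEquivalence ≈ₚ-setoid
                  ; ∙-cong        = λ {P P′ Q Q′} → ++-cong {P} {P′} {Q} {Q′}
                  }
                ; assoc = λ P Q S e → begin
                    coeff ((P ++ Q) ++ S) e           ≈⟨ trans (coeff-++ (P ++ Q) S e) (+-congʳ (coeff-++ P Q e)) ⟩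
                    (coeff P e + coeff Q e) + coeff S e ≈⟨ +-assoc _ _ _ ⟩
                    coeff P e + (coeff Q e + coeff S e) ≈⟨ sym (trans (coeff-++ P (Q ++ S) e) (+-congˡ (coeff-++ Q S e))) ⟩
                    coeff (P ++ (Q ++ S)) e           ∎
                }
              ; identity = (λ P e → refl) , (λ P e → trans (coeff-++ P [] e) (+-identityʳ _))
              }
            ; inverse = (λ P e → trans (coeff-++ (neg P) P e) (trans (+-congʳ (coeff-neg P e)) (-‿inverseˡ _)))
                      , (λ P e → trans (coeff-++ P (neg P) e) (trans (+-congˡ (coeff-neg P e)) (-‿inverseʳ _)))
            ; ⁻¹-cong = λ {P} {Q} P≈Q e → trans (coeff-neg P e) (trans (-‿cong (P≈Q e)) (sym (coeff-neg Q e)))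
            }
          ; comm = λ P Q e → trans (coeff-++ P Q e) (trans (+-comm _ _) (sym (coeff-++ Q P e)))
          }
        ; *-cong     = λ {P P′ Q Q′} → ·-cong {P} {P′} {Q} {Q′}
        ; *-assoc    = ·-assoc
        ; *-identity = comm∧idˡ⇒id {_∙_ = _·_} ·-comm ·-identityˡ
        ; distrib    = comm∧distrˡ⇒distr {_∙_ = _·_} {_◦_ = _++_} (λ {P P′ Q Q′} → ++-cong {P} {P′} {Q} {Q′})
                                         ·-comm ·-distribˡ-++
        }
      ; *-comm = ·-comm
      }
    }

  powₚ : Poly n → ℕ → Poly n
  powₚ = RingOps.pow (CommutativeRing.rawRing polynomialRing)

  singleExp : Fin n → ℕ → Fin n → ℕ
  singleExp j e i with i Fin.≟ j
  ... | yes _ = e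
  ... | no  _ = 0

  exponents : Poly n → Vec ℕ n
  exponents []            = replicate n 0
  exponents ((_ , m) ∷ _) = m

  -- The exponent function of varPow is local to its definition, so it is reached through lookup∘tabulate.
  lookup-varPow : ∀ j e i → lookup (exponents (varPow j e)) i ≡ singleExp j e i
  lookup-varPow j e i with ≡.trans (≡.refl {x = lookup (exponents (varPow j e)) i}) (Vecₚ.lookup∘tabulate _ i)
  ... | eq with i Fin.≟ j
  ...   | yes _ = eq
  ...   | no  _ = eq

  vec-ext : ∀ {u v : Vec ℕ n} → (∀ i → lookup u i ≡ lookup v i) → u ≡ v
  vec-ext {u} {v} eq = ≡.trans (≡.sym (Vecₚ.tabulate∘lookup u)) (≡.trans (Vecₚ.tabulate-cong eq) (Vecₚ.tabulate∘lookup v))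

  varPow≡ : ∀ j e → varPow j e ≡ (1# , tabulate (singleExp j e)) ∷ []
  varPow≡ j e = ≡.cong (λ v → (1# , v) ∷ []) (vec-ext λ i → ≡.trans (lookup-varPow j e i) (≡.sym (Vecₚ.lookup∘tabulate _ i)))

  singleExp-zero : ∀ j i → singleExp j 0 i ≡ 0
  singleExp-zero j i with i Fin.≟ j
  ... | yes _ = ≡.refl
  ... | no  _ = ≡.refl

  singleExp-suc : ∀ j e i → singleExp j 1 i +ℕ singleExp j e i ≡ singleExp j (suc e) i
  singleExp-suc j e i with i Fin.≟ j
  ... | yes _ = ≡.refl
  ... | no  _ = ≡.refl

  singleExp-self : ∀ j e → singleExp j e j ≡ e
  singleExp-self j e with j Fin.≟ j
  ... | yes _   = ≡.refl
  ... | no  j≢j = ⊥-elim (j≢j ≡.refl)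

  singleExp-other : ∀ {j i} e → i ≢ j → singleExp j e i ≡ 0
  singleExp-other {j} {i} e i≢j with i Fin.≟ j
  ... | yes i≡j = ⊥-elim (i≢j i≡j)
  ... | no  _   = ≡.refl

  singleton-cong : ∀ {a b} {m : Vec ℕ n} → a ≈ b → ((a , m) ∷ []) ≈ₚ ((b , m) ∷ [])
  singleton-cong {a} {b} {m} a≈b e with Vecₚ.≡-dec _≟_ m e
  ... | yes _ = +-congʳ a≈b
  ... | no  _ = refl

  varPow-pow : ∀ j e → varPow j e ≈ₚ powₚ (varPow j 1) e
  varPow-pow j zero    e = reflexive (≡.cong (λ P → coeff P e) (≡.trans (varPow≡ j 0)
    (≡.cong (λ v → (1# , v) ∷ []) (vec-ext {v = replicate n 0} λ i →
      ≡.trans (Vecₚ.lookup∘tabulate _ i) (≡.trans (singleExp-zero j i) (≡.sym (Vecₚ.lookup-replicate i 0)))))))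
  varPow-pow j (suc k) e = begin
    coeff (varPow j (suc k)) e                    ≡⟨ ≡.cong (λ P → coeff P e) (≡.trans (varPow≡ j (suc k))
                                                       (≡.cong (λ v → (1# , v) ∷ []) exponent-sum)) ⟩
    coeff ((1# , m₁ ⊕ mₖ) ∷ []) e                 ≈⟨ singleton-cong {m = m₁ ⊕ mₖ} (sym (*-identityˡ 1#)) e ⟩
    coeff ((1# * 1# , m₁ ⊕ mₖ) ∷ []) e            ≡⟨ ≡.cong (λ P → coeff P e) (≡.sym (≡.cong₂ _·_ (varPow≡ j 1) (varPow≡ j k))) ⟩
    coeff (varPow j 1 · varPow j k) e             ≈⟨ ·-congʳ (varPow j 1) {varPow j k} {powₚ (varPow j 1) k} (varPow-pow j k) e ⟩
    coeff (varPow j 1 · powₚ (varPow j 1) k) e    ∎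
    where
    m₁ mₖ : Vec ℕ n
    m₁ = tabulate (singleExp j 1)
    mₖ = tabulate (singleExp j k)
    exponent-sum : tabulate (singleExp j (suc k)) ≡ m₁ ⊕ mₖ
    exponent-sum = vec-ext {v = m₁ ⊕ mₖ} λ i →
      ≡.trans (Vecₚ.lookup∘tabulate _ i) (≡.trans (≡.sym (singleExp-suc j k i)) (≡.sym
        (≡.trans (Vecₚ.lookup-zipWith _+ℕ_ i m₁ mₖ) (≡.cong₂ _+ℕ_ (Vecₚ.lookup∘tabulate _ i) (Vecₚ.lookup∘tabulate _ i)))))

module Homomorphism {c₁ ℓ₁ c₂ ℓ₂} (R₁ : CommutativeRing c₁ ℓ₁) (R₂ : CommutativeRing c₂ ℓ₂) where
  private
    module R₁ = CommutativeRing R₁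
    module D₁ = Determinant R₁
    module J₁ = JacobiTrudi R₁
    module S₁ = RingOps R₁.rawRing
  open CommutativeRing R₂ hiding (zero)
  open RingOps rawRing using (sign)
  open Determinant R₂
  open JacobiTrudi R₂
  open import Relation.Binary.Reasoning.Setoid setoid

  record IsRingHomomorphism (h : R₁.Carrier → Carrier) : Set (c₁ ⊔ ℓ₂) where
    field
      +-homo  : ∀ x y → h (x R₁.+ y) ≈ h x + h y
      *-homo  : ∀ x y → h (x R₁.* y) ≈ h x * h y
      -‿homo  : ∀ x → h (R₁.- x) ≈ - h x
      0#-homo : h R₁.0# ≈ 0#
      1#-homo : h R₁.1# ≈ 1#

  module _ {h : R₁.Carrier → Carrier} (isHom : IsRingHomomorphism h) where
    open IsRingHomomorphism isHom

    ∑-homo : ∀ n g → h (D₁.∑ n g) ≈ ∑[ i < n ] h (g i)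
    ∑-homo zero    g = trans (reflexive (≡.cong h (D₁.∑-empty g))) (trans 0#-homo (reflexive (≡.sym (∑-empty _))))
    ∑-homo (suc n) g = begin
      h (D₁.∑ (suc n) g)                    ≡⟨ ≡.cong h (D₁.∑-suc n g) ⟩
      h (g 0 R₁.+ D₁.∑ n (g ∘ suc))         ≈⟨ trans (+-homo _ _) (+-congˡ (∑-homo n (g ∘ suc))) ⟩
      h (g 0) + ∑[ i < n ] h (g (suc i))    ≡⟨ ∑-suc n _ ⟨
      ∑[ i < suc n ] h (g i)                ∎

    sign-homo : ∀ k → h (S₁.sign k) ≈ sign k
    sign-homo zero    = 1#-homo
    sign-homo (suc k) = trans (-‿homo _) (-‿cong (sign-homo k))

    det-homo : ∀ n f → h (D₁.det n f) ≈ det n (λ r s → h (f r s))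
    det-homo zero    f = 1#-homo
    det-homo (suc n) f = trans (∑-homo (suc n) _) (∑-cong λ j _ →
      trans (*-homo _ _) (*-cong (sign-homo j) (trans (*-homo _ _) (*-congˡ (det-homo n (D₁.minor j f))))))

    eᶜ-homo : ∀ n x s → h (J₁.eᶜ n x s) ≈ eᶜ n (h ∘ x) s
    eᶜ-homo zero    x zero    = 1#-homo
    eᶜ-homo zero    x (suc s) = 0#-homo
    eᶜ-homo (suc n) x zero    = trans (*-homo _ _) (*-congˡ (eᶜ-homo n (x ∘ suc) zero))
    eᶜ-homo (suc n) x (suc s) = trans (+-homo _ _)
      (+-cong (trans (*-homo _ _) (*-congˡ (eᶜ-homo n (x ∘ suc) (suc s)))) (eᶜ-homo n (x ∘ suc) s))

    eMatrix-homo : ∀ n off x i k → h (J₁.eMatrix n off x i k) ≈ eMatrix n off (h ∘ x) i k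
    eMatrix-homo n off x i k with k ≤? off +ℕ i
    ... | yes _ = eᶜ-homo n x (off +ℕ i ∸ k)
    ... | no  _ = 0#-homo

module Evaluation {c ℓ} (𝕂 : Field c ℓ) {n : ℕ} (w : Fin n → Field.Carrier 𝕂) where
  open FieldDefs 𝕂
  open CommutativeRing (Field.commutativeRing 𝕂)
    using (refl; sym; trans; reflexive; setoid; +-cong; +-congˡ; +-congʳ; *-cong; *-congˡ; *-congʳ; *-comm;
           +-identityʳ; *-identityˡ; *-identityʳ; *-commutativeSemigroup; ring)
  open import Algebra.Properties.Ring ring using (-‿distribˡ-*; -‿+-comm; -0#≈0#)
  open import Algebra.Properties.CommutativeSemigroup *-commutativeSemigroup using (interchange)
  open import Relation.Binary.Reasoning.Setoid setoid
  open Determinant (Field.commutativeRing 𝕂) using (pow-+)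
  open Polynomials 𝕂 n
  open Homomorphism polynomialRing (Field.commutativeRing 𝕂) using (IsRingHomomorphism)

  ΠF-cong : ∀ {k} {f g : Fin k → Carrier} → (∀ i → f i ≈ g i) → ΠF f ≈ ΠF g
  ΠF-cong {zero}  _  = refl
  ΠF-cong {suc k} eq = *-cong (eq fzero) (ΠF-cong (eq ∘ fsuc))

  ΠF-distrib-* : ∀ {k} (f g : Fin k → Carrier) → ΠF (λ i → f i * g i) ≈ ΠF f * ΠF g
  ΠF-distrib-* {zero}  f g = sym (*-identityˡ 1#)
  ΠF-distrib-* {suc k} f g = trans (*-congˡ (ΠF-distrib-* (f ∘ fsuc) (g ∘ fsuc))) (interchange _ _ _ _)

  ΠF-ones : ∀ {k} {f : Fin k → Carrier} → (∀ i → f i ≈ 1#) → ΠF f ≈ 1#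
  ΠF-ones {zero}  _  = refl
  ΠF-ones {suc k} eq = trans (*-cong (eq fzero) (ΠF-ones (eq ∘ fsuc))) (*-identityˡ 1#)

  ΠF-single : ∀ {k} (f : Fin k → Carrier) j → (∀ i → i ≢ j → f i ≈ 1#) → ΠF f ≈ f j
  ΠF-single {suc k} f fzero    ones = trans (*-congˡ (ΠF-ones λ i → ones (fsuc i) λ ())) (*-identityʳ _)
  ΠF-single {suc k} f (fsuc j) ones = trans (*-cong (ones fzero λ ())
    (ΠF-single (f ∘ fsuc) j λ i i≢j → ones (fsuc i) (i≢j ∘ Finₚ.suc-injective))) (*-identityˡ _)

  monomial : Vec ℕ n → Carrier
  monomial m = ΠF (λ i → pow (w i) (lookup m i))

  monomial-⊕ : ∀ m m′ → monomial (m ⊕ m′) ≈ monomial m * monomial m′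
  monomial-⊕ m m′ = trans (ΠF-cong λ i → trans (reflexive (≡.cong (pow (w i)) (Vecₚ.lookup-zipWith _+ℕ_ i m m′)))
                                                (pow-+ (w i) (lookup m i) (lookup m′ i)))
                          (ΠF-distrib-* (λ i → pow (w i) (lookup m i)) (λ i → pow (w i) (lookup m′ i)))

  evalP≈∑ₗ : ∀ P → evalP w P ≈ ∑ₗ P (λ t → proj₁ t * monomial (proj₂ t))
  evalP≈∑ₗ []            = sym (∑ₗ-[] _)
  evalP≈∑ₗ ((a , m) ∷ P) = trans (+-congˡ (evalP≈∑ₗ P)) (sym (∑ₗ-∷ _ P _))

  evalP-++ : ∀ P Q → evalP w (P ++ Q) ≈ evalP w P + evalP w Q
  evalP-++ P Q = trans (evalP≈∑ₗ (P ++ Q)) (trans (∑ₗ-++ P Q _) (sym (+-cong (evalP≈∑ₗ P) (evalP≈∑ₗ Q))))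

  evalP-· : ∀ P Q → evalP w (P · Q) ≈ evalP w P * evalP w Q
  evalP-· P Q = begin
    evalP w (P · Q)                          ≈⟨ evalP≈∑ₗ (P · Q) ⟩
    ∑ₗ (P · Q) g                             ≈⟨ trans (∑ₗ-concatMap _ P g) (∑ₗ-cong P λ t → ∑ₗ-map (t ⊙_) Q g) ⟩
    ∑ₗ P (λ t → ∑ₗ Q (λ u → g (t ⊙ u)))      ≈⟨ ∑ₗ-cong P (λ t → ∑ₗ-cong Q λ u →
                                                  trans (*-congˡ (monomial-⊕ (proj₂ t) (proj₂ u))) (interchange _ _ _ _)) ⟩
    ∑ₗ P (λ t → ∑ₗ Q (λ u → g t * g u))      ≈⟨ ∑ₗ-cong P (λ t → sym (*-distribˡ-∑ₗ (g t) Q g)) ⟩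
    ∑ₗ P (λ t → g t * ∑ₗ Q g)                ≈⟨ trans (∑ₗ-cong P λ t → *-comm (g t) _) (sym (*-distribˡ-∑ₗ _ P g)) ⟩
    ∑ₗ Q g * ∑ₗ P g                          ≈⟨ *-comm _ _ ⟩
    ∑ₗ P g * ∑ₗ Q g                          ≈⟨ sym (*-cong (evalP≈∑ₗ P) (evalP≈∑ₗ Q)) ⟩
    evalP w P * evalP w Q                    ∎
    where
    g : Term → Carrier
    g t = proj₁ t * monomial (proj₂ t)

  evalP-neg : ∀ P → evalP w (neg P) ≈ - evalP w P
  evalP-neg []            = sym -0#≈0#
  evalP-neg ((a , m) ∷ P) = trans (+-cong (sym (-‿distribˡ-* a _)) (evalP-neg P)) (-‿+-comm _ _)

  evalP-one : evalP w one ≈ 1#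
  evalP-one = trans (+-identityʳ _) (trans (*-identityˡ _)
    (ΠF-ones λ i → reflexive (≡.cong (pow (w i)) (Vecₚ.lookup-replicate i 0))))

  evalP-isRingHomomorphism : IsRingHomomorphism (evalP w)
  evalP-isRingHomomorphism = record
    { +-homo = evalP-++ ; *-homo = evalP-· ; -‿homo = evalP-neg ; 0#-homo = refl ; 1#-homo = evalP-one }

  evalP-variable : ∀ j → evalP w (varPow j 1) ≈ w j
  evalP-variable j = begin
    evalP w (varPow j 1)                                     ≡⟨ ≡.cong (evalP w) (varPow≡ j 1) ⟩
    1# * ΠF (λ i → pow (w i) (lookup (tabulate (singleExp j 1)) i)) + 0#
                                                             ≈⟨ trans (+-identityʳ _) (*-identityˡ _) ⟩
    ΠF (λ i → pow (w i) (lookup (tabulate (singleExp j 1)) i))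
                                                             ≈⟨ ΠF-single _ j (λ i i≢j → reflexive (≡.cong (pow (w i))
                                                                  (≡.trans (Vecₚ.lookup∘tabulate _ i) (singleExp-other 1 i≢j)))) ⟩
    pow (w j) (lookup (tabulate (singleExp j 1)) j)          ≡⟨ ≡.cong (pow (w j)) (≡.trans (Vecₚ.lookup∘tabulate _ j)
                                                                                             (singleExp-self j 1)) ⟩
    w j * 1#                                                 ≈⟨ *-identityʳ _ ⟩
    w j                                                      ∎

module MultiplicationMap {c ℓ} (𝕂 : Field c ℓ) where
  open FieldDefs 𝕂
  open Field 𝕂 using (commutativeRing; ⁻¹-inverseʳ)
  open CommutativeRing commutativeRing
    using (refl; sym; trans; reflexive; setoid; +-cong; *-cong; *-congˡ; *-congʳ; *-assoc; *-comm;
           *-identityˡ; *-identityʳ; distribˡ; zeroˡ; zeroʳ; *-commutativeSemigroup)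
  open import Algebra.Properties.CommutativeSemigroup *-commutativeSemigroup using (interchange)
  open import Relation.Binary.Reasoning.Setoid setoid
  open Determinant commutativeRing using (det-cong; detFin≈det; det-scale; ∏-const; ∏-ones) renaming (det to detℕ)
  open JacobiTrudi commutativeRing using (eᶜ; eMatrix; eMatrix-≤; eMatrix-≰; eMatrix-cong)

  rect≡rectℕ : ∀ {n} m L (i : Fin n) → rect m L i ≡ rectℕ m L (toℕ i)
  rect≡rectℕ m L i with toℕ i <? L
  ... | yes _ = ≡.refl
  ... | no  _ = ≡.refl

  extend-cong : ∀ {k} {f g : Fin k → Carrier} d t → (∀ i → f i ≈ g i) → extend f d t ≈ extend g d t
  extend-cong {zero}          d t       eq = refl
  extend-cong {suc k}         d zero    eq = eq fzero
  extend-cong {suc k} {f} {g} d (suc t) eq = extend-cong {f = f ∘ fsuc} {g ∘ fsuc} d t (eq ∘ fsuc)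

  schur-rectangle : ∀ {n} L off m → L +ℕ off ≡ n →
                    Σ (Poly n) λ P → IsSchurPoly n (rect m L) P ×
                                     (∀ w → evalP w P ≈ detℕ m (eMatrix n off (extend w 0#)))
  schur-rectangle {n} L off m ≡.refl = P , isSchur , evaluation
    where
    open Polynomials 𝕂 n
    module Dₚ = Determinant polynomialRing
    module Jₚ = JacobiTrudi polynomialRing
    z : ℕ → Poly n
    z = extend (λ j → varPow j 1) []
    P : Poly n
    P = Dₚ.det m (Jₚ.eMatrix n off z)
    alternant≈ : ∀ (μ : Fin n → ℕ) μ′ → (∀ i → μ i ≡ μ′ (toℕ i)) →
                 alternant n μ ≈ₚ Dₚ.det n (Jₚ.alternantMatrix n μ′ z)
    alternant≈ μ μ′ μ≡μ′ = Dₚ.detFin≈det _ _ λ r s →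
      ≡.subst₂ (λ e Z → varPow s (e +ℕ (n ∸ 1 ∸ toℕ r)) ≈ₚ powₚ Z (μ′ (toℕ r) +ℕ (n ∸ 1 ∸ toℕ r)))
               (≡.sym (μ≡μ′ r)) (≡.sym (extend-toℕ _ [] s)) (varPow-pow s _)
    isSchur : IsSchurPoly n (rect m L) P
    isSchur e = begin
      coeff (P · alternant n (λ _ → 0)) e                      ≈⟨ ·-congʳ P (alternant≈ _ (λ _ → 0) (λ _ → ≡.refl)) e ⟩
      coeff (P · Dₚ.det n (Jₚ.alternantMatrix n (λ _ → 0) z)) e ≈⟨ Jₚ.dual-Jacobi-Trudi L off m z e ⟩
      coeff (Dₚ.det n (Jₚ.alternantMatrix n (rectℕ m L) z)) e  ≈⟨ sym (alternant≈ (rect m L) (rectℕ m L) (rect≡rectℕ m L) e) ⟩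
      coeff (alternant n (rect m L)) e                         ∎
    evaluation : ∀ w → evalP w P ≈ detℕ m (eMatrix n off (extend w 0#))
    evaluation w = begin
      evalP w P                                         ≈⟨ det-homo evalP-isRingHomomorphism m _ ⟩
      detℕ m (λ r s → evalP w (Jₚ.eMatrix n off z r s)) ≈⟨ det-cong m (λ r s _ _ → trans
                                                              (eMatrix-homo evalP-isRingHomomorphism n off z r s)
                                                              (eMatrix-cong n off r s variables)) ⟩
      detℕ m (eMatrix n off (extend w 0#))              ∎
      where
      open Evaluation 𝕂 w
      open Homomorphism polynomialRing commutativeRing using (det-homo; eMatrix-homo)
      variables : ∀ t → evalP w (z t) ≈ extend w 0# t
      variables t = trans (reflexive (extend-∘ (evalP w) (λ j → varPow j 1) [] t)) (extend-cong 0# t evalP-variable)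

  prodCoeff≈eᶜ : ∀ {k} (a b : Fin k → Carrier) → ¬ (ΠF b ≈ 0#) → ∀ s →
                 prodCoeff a b s ≈ ΠF b * eᶜ k (extend (ratio a b) 0#) s
  prodCoeff≈eᶜ {zero}  a b _ zero    = sym (*-identityˡ 1#)
  prodCoeff≈eᶜ {zero}  a b _ (suc s) = sym (zeroʳ 1#)
  prodCoeff≈eᶜ {suc k} a b β≢0 s = expand s
    where
    a₀ b₀ β′ : Carrier
    a₀ = a fzero
    b₀ = b fzero
    β′ = ΠF (b ∘ fsuc)
    e′ : ℕ → Carrier
    e′ = eᶜ k (extend (ratio (a ∘ fsuc) (b ∘ fsuc)) 0#)
    tail : ∀ t → prodCoeff (a ∘ fsuc) (b ∘ fsuc) t ≈ β′ * e′ t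
    tail = prodCoeff≈eᶜ (a ∘ fsuc) (b ∘ fsuc) (λ β′≈0 → β≢0 (trans (*-congˡ β′≈0) (zeroʳ b₀)))
    b₀-cancel : b₀ * (a₀ * b₀ ⁻¹) ≈ a₀
    b₀-cancel = begin
      b₀ * (a₀ * b₀ ⁻¹)  ≈⟨ *-congˡ (*-comm _ _) ⟩
      b₀ * (b₀ ⁻¹ * a₀)  ≈⟨ sym (*-assoc _ _ _) ⟩
      (b₀ * b₀ ⁻¹) * a₀  ≈⟨ *-congʳ (⁻¹-inverseʳ b₀ λ b₀≈0 → β≢0 (trans (*-congʳ b₀≈0) (zeroˡ _))) ⟩
      1# * a₀            ≈⟨ *-identityˡ _ ⟩
      a₀                 ∎
    x₀-term : ∀ t → (b₀ * β′) * ((a₀ * b₀ ⁻¹) * e′ t) ≈ a₀ * (β′ * e′ t)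
    x₀-term t = trans (interchange _ _ _ _) (*-congʳ b₀-cancel)
    expand : ∀ s → prodCoeff a b s ≈ (b₀ * β′) * eᶜ (suc k) (extend (ratio a b) 0#) s
    expand zero    = trans (*-congˡ (tail zero)) (sym (x₀-term zero))
    expand (suc s) = begin
      a₀ * prodCoeff (a ∘ fsuc) (b ∘ fsuc) (suc s) + b₀ * prodCoeff (a ∘ fsuc) (b ∘ fsuc) s
        ≈⟨ +-cong (*-congˡ (tail (suc s))) (*-congˡ (tail s)) ⟩
      a₀ * (β′ * e′ (suc s)) + b₀ * (β′ * e′ s)
        ≈⟨ +-cong (sym (x₀-term (suc s))) (sym (*-assoc _ _ _)) ⟩
      (b₀ * β′) * ((a₀ * b₀ ⁻¹) * e′ (suc s)) + (b₀ * β′) * e′ s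
        ≈⟨ sym (distribˡ _ _ _) ⟩
      (b₀ * β′) * ((a₀ * b₀ ⁻¹) * e′ (suc s) + e′ s) ∎

  Ddet≈det : ∀ {N} d q k (a b : Fin N → Carrier) → k ≤ d → ¬ (ΠF b ≈ 0#) →
             Ddet d q k a b ≈ pow (ΠF b) (dimR d q k) *
                              detℕ (dimR d q k) (eMatrix N ((d +ℕ q ∸ k) ∸ d) (extend (ratio a b) 0#))
  Ddet≈det {N} d q k a b k≤d β≢0 = begin
    Ddet d q k a b
      ≈⟨ detFin≈det _ _ entry ⟩
    detℕ m (λ r s → β * (1# * E r s))
      ≈⟨ det-scale m (λ _ → β) (λ _ → 1#) (λ _ _ → refl) ⟩
    (∏ m (λ _ → β) * ∏ m (λ _ → 1#)) * detℕ m E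
      ≈⟨ *-congʳ (trans (*-cong (∏-const m β) (∏-ones λ _ _ → refl)) (*-identityʳ _)) ⟩
    pow β m * detℕ m E ∎
    where
    open Determinant commutativeRing using (∏)
    m off : ℕ
    m = dimR d q k
    off = (d +ℕ q ∸ k) ∸ d
    β : Carrier
    β = ΠF b
    E : ℕ → ℕ → Carrier
    E = eMatrix N off (extend (ratio a b) 0#)
    k∸d≡0 : k ∸ d ≡ 0
    k∸d≡0 = ℕₚ.m≤n⇒m∸n≡0 k≤d
    entry : ∀ (r s : Fin m) → multMatrix d q k a b r s ≈ β * (1# * E (toℕ r) (toℕ s))
    entry r s with (k ∸ d) +ℕ toℕ s ≤? off +ℕ toℕ r
    ... | yes le = begin
      prodCoeff a b (off +ℕ toℕ r ∸ ((k ∸ d) +ℕ toℕ s))   ≡⟨ ≡.cong (λ j → prodCoeff a b (off +ℕ toℕ r ∸ (j +ℕ toℕ s))) k∸d≡0 ⟩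
      prodCoeff a b (off +ℕ toℕ r ∸ toℕ s)                ≈⟨ prodCoeff≈eᶜ a b β≢0 _ ⟩
      β * eᶜ N (extend (ratio a b) 0#) (off +ℕ toℕ r ∸ toℕ s)
        ≈⟨ *-congˡ (sym (trans (*-identityˡ _) (eMatrix-≤ (≡.subst (_≤ off +ℕ toℕ r) (≡.cong (_+ℕ toℕ s) k∸d≡0) le)))) ⟩
      β * (1# * E (toℕ r) (toℕ s))                        ∎
    ... | no  nle = sym (trans (*-congˡ (trans (*-identityˡ _)
                      (eMatrix-≰ λ le → nle (≡.subst (_≤ off +ℕ toℕ r) (≡.sym (≡.cong (_+ℕ toℕ s) k∸d≡0)) le))))
                      (zeroʳ β))

  dimR-small : ∀ {d q k} → k ≤ d → k ≤ q → dimR d q k ≡ suc k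
  dimR-small {d} {q} {k} k≤d k≤q =
    ≡.trans (≡.cong (suc (q ⊓ k) ∸_) (ℕₚ.m≤n⇒m∸n≡0 k≤d)) (≡.cong suc (ℕₚ.m≥n⇒m⊓n≡n k≤q))

  dimR-large : ∀ {d q k} → k ≤ d → q ≤ k → dimR d q k ≡ suc q
  dimR-large {d} {q} {k} k≤d q≤k =
    ≡.trans (≡.cong (suc (q ⊓ k) ∸_) (ℕₚ.m≤n⇒m∸n≡0 k≤d)) (≡.cong suc (ℕₚ.m≤n⇒m⊓n≡m q≤k))

  Ddet-schur : ∀ d q k {m L} (a b : Fin (d +ℕ q ∸ 2 *ℕ k) → Carrier) → k ≤ d → ¬ (ΠF b ≈ 0#) →
               dimR d q k ≡ m → L +ℕ ((d +ℕ q ∸ k) ∸ d) ≡ d +ℕ q ∸ 2 *ℕ k →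
               Σ (Poly (d +ℕ q ∸ 2 *ℕ k)) λ P → IsSchurPoly (d +ℕ q ∸ 2 *ℕ k) (rect m L) P ×
                                                (Ddet d q k a b ≈ pow (ΠF b) m * evalP (ratio a b) P)
  Ddet-schur d q k {L = L} a b k≤d β≢0 ≡.refl L+off≡n with schur-rectangle L _ (dimR d q k) L+off≡n
  ... | P , isSchur , evaluation =
    P , isSchur , trans (Ddet≈det d q k a b k≤d β≢0) (*-congˡ (sym (evaluation (ratio a b))))

2k≤d+q⇒k≤d : ∀ {d q k} → q ≤ d → 2 *ℕ k ≤ d +ℕ q → k ≤ d
2k≤d+q⇒k≤d {d} {q} {k} q≤d 2k≤d+q = ℕₚ.*-cancelˡ-≤ 2 (ℕₚ.≤-trans 2k≤d+q
  (ℕₚ.≤-trans (ℕₚ.+-monoʳ-≤ d q≤d) (ℕₚ.≤-reflexive (≡.cong (d +ℕ_) (≡.sym (ℕₚ.+-identityʳ d))))))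

offset-small : ∀ {d q k} → k ≤ q → (d +ℕ q ∸ k) ∸ d ≡ q ∸ k
offset-small {d} {q} {k} k≤q = ≡.trans (≡.cong (_∸ d) (ℕₚ.+-∸-assoc d k≤q)) (ℕₚ.m+n∸m≡n d (q ∸ k))

offset-large : ∀ {d q k} → q ≤ k → (d +ℕ q ∸ k) ∸ d ≡ 0
offset-large {d} {q} {k} q≤k = ℕₚ.m≤n⇒m∸n≡0
  (ℕₚ.≤-trans (ℕₚ.∸-monoˡ-≤ k (ℕₚ.+-monoʳ-≤ d q≤k)) (ℕₚ.≤-reflexive (ℕₚ.m+n∸n≡m d k)))

degree-split : ∀ {d q k} → k ≤ d → k ≤ q → (d ∸ k) +ℕ (q ∸ k) ≡ d +ℕ q ∸ 2 *ℕ k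
degree-split {d} {q} {k} k≤d k≤q = ≡.sym (begin
  d +ℕ q ∸ 2 *ℕ k                              ≡⟨ ≡.cong₂ (λ x y → x +ℕ y ∸ 2 *ℕ k)
                                                    (≡.sym (ℕₚ.m∸n+n≡m k≤d)) (≡.sym (ℕₚ.m∸n+n≡m k≤q)) ⟩
  ((d ∸ k) +ℕ k) +ℕ ((q ∸ k) +ℕ k) ∸ 2 *ℕ k    ≡⟨ ≡.cong (_∸ 2 *ℕ k) (shuffle (d ∸ k) (q ∸ k) k) ⟩
  ((d ∸ k) +ℕ (q ∸ k)) +ℕ 2 *ℕ k ∸ 2 *ℕ k      ≡⟨ ℕₚ.m+n∸n≡m _ (2 *ℕ k) ⟩
  (d ∸ k) +ℕ (q ∸ k)                           ∎)
  where
  open ≡.≡-Reasoning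
  shuffle : ∀ a b k → (a +ℕ k) +ℕ (b +ℕ k) ≡ (a +ℕ b) +ℕ 2 *ℕ k
  shuffle = solve-∀

corollary3p3 : ∀ {c ℓ} (𝕂 : Field c ℓ) → let open FieldDefs 𝕂 in
    (d q k : ℕ) → 1 ≤ q → q ≤ d → 2 *ℕ k ≤ d +ℕ q →
    (a b : Fin (d +ℕ q ∸ 2 *ℕ k) → Carrier) → ¬ (ΠF b ≈ 0#) →
      (k ≤ q → Σ (Poly (d +ℕ q ∸ 2 *ℕ k)) (λ P →
         IsSchurPoly (d +ℕ q ∸ 2 *ℕ k) (rect (suc k) (d ∸ k)) P
         × (Ddet d q k a b ≈ pow (ΠF b) (suc k) * evalP (ratio a b) P)))
      × (q ≤ k → Σ (Poly (d +ℕ q ∸ 2 *ℕ k)) (λ P →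
         IsSchurPoly (d +ℕ q ∸ 2 *ℕ k) (rect (suc q) (d +ℕ q ∸ 2 *ℕ k)) P
         × (Ddet d q k a b ≈ pow (ΠF b) (suc q) * evalP (ratio a b) P)))
corollary3p3 𝕂 d q k _ q≤d 2k≤d+q a b β≢0 =
  (λ k≤q → Ddet-schur d q k a b k≤d β≢0 (dimR-small k≤d k≤q)
             (≡.trans (≡.cong ((d ∸ k) +ℕ_) (offset-small {d} k≤q)) (degree-split k≤d k≤q))) ,
  (λ q≤k → Ddet-schur d q k a b k≤d β≢0 (dimR-large k≤d q≤k)
             (≡.trans (≡.cong ((d +ℕ q ∸ 2 *ℕ k) +ℕ_) (offset-large {d} q≤k)) (ℕₚ.+-identityʳ _)))
  where
  open MultiplicationMap 𝕂
  k≤d : k ≤ d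
  k≤d = 2k≤d+q⇒k≤d q≤d 2k≤d+q
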